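{- For $\gamma\in\mathrm{GL}_r(A)$ and $\mathbf z\in\Omega^r$ let $\mathfrak C^\gamma(\mathbf z)=(\mathfrak c^\gamma_{jl}(\mathbf z))_{1\leq j,l\leq r-1}\in\mathrm{Mat}_{r-1}(\mathbb{C}_\infty)$. Then (i) $\det(\mathfrak C^\gamma(\mathbf z))=\det(\gamma)^{r-2}j(\gamma,\mathbf z)$; (ii) $\mathfrak C^{\gamma^{ -1}}(\gamma\cdot\mathbf z)^{ -1}=\mathfrak C^\gamma(\mathbf z)$.
   Context: Let $q$ be a prime power, $A=\mathbb{F}_q[\theta]$, $K_\infty=\mathbb{F}_q((1/\theta))$, $\mathbb{C}_\infty$ the completion of an algebraic closure of $K_\infty$, $r\geq2$. $\Omega^r$: $\mathbf z=(z_1,\dots,z_r)^{\mathrm{tr}}\in\mathbb{C}_\infty^r$ with $z_r=1$ and entries $K_\infty$-linearly independent. For $\gamma=(a_{\nu\mu})\in\mathrm{GL}_r(A)$: $j(\gamma,\mathbf z)=a_{r1}z_1+\cdots+a_{rr}z_r$, $\gamma\cdot\mathbf z=\gamma\mathbf z/j(\gamma,\mathbf z)\in\Omega^r$, $c^\gamma_{jl}$ is the $(j,l)$-cofactor of $\gamma$, and $\mathfrak c^\gamma_{jl}(\mathbf z)=c^\gamma_{jl}-c^\gamma_{jr}z_l$ for $1\leq j,l\leq r-1$. -}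

module Defs where

open import Level using (Level; _⊔_)
open import Data.Nat using (ℕ; zero; suc) renaming (_+_ to _+ℕ_)
open import Data.Fin using (Fin; zero; suc; toℕ; punchIn; inject₁; fromℕ; _≟_)
open import Data.Product using (_×_)
open import Relation.Nullary using (¬_; yes; no)
open import Relation.Unary using (Pred)
open import Function.Definitions using (Injective)
open import Algebra.Bundles using (CommutativeRing)
open import Algebra.Morphism.Structures using (IsRingHomomorphism)

Matrix : ∀ {a} → Set a → ℕ → ℕ → Set a
Matrix X m n = Fin m → Fin n → X

module Lin {c ℓ} (R : CommutativeRing c ℓ) where
  open CommutativeRing R using (Carrier; _≈_; _+_; _*_; -_; _-_; 0#; 1#)

  ∑ : ∀ {n} → (Fin n → Carrier) → Carrier
  ∑ {zero}  f = 0#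
  ∑ {suc n} f = f zero + ∑ (λ i → f (suc i))

  sign : ℕ → Carrier
  sign zero    = 1#
  sign (suc k) = - sign k

  pow : Carrier → ℕ → Carrier
  pow x zero    = 1#
  pow x (suc k) = x * pow x k

  minor : ∀ {n} → Fin (suc n) → Fin (suc n) → Matrix Carrier (suc n) (suc n) → Matrix Carrier n n
  minor i j M a b = M (punchIn i a) (punchIn j b)

  det : ∀ {n} → Matrix Carrier n n → Carrier
  det {zero}  M = 1#
  det {suc n} M = ∑ (λ j → sign (toℕ j) * (M zero j * det (minor zero j M)))

  cofactor : ∀ {n} → Matrix Carrier (suc n) (suc n) → Fin (suc n) → Fin (suc n) → Carrier
  cofactor M j l = sign (toℕ j +ℕ toℕ l) * det (minor j l M)

  _⊗_ : ∀ {m n p} → Matrix Carrier m n → Matrix Carrier n p → Matrix Carrier m p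
  (M ⊗ N) i k = ∑ (λ j → M i j * N j k)

  I : ∀ {n} → Matrix Carrier n n
  I i j with i ≟ j
  ... | yes _ = 1#
  ... | no  _ = 0#

  _≈ᴹ_ : ∀ {m n} → Matrix Carrier m n → Matrix Carrier m n → Set ℓ
  M ≈ᴹ N = ∀ i j → M i j ≈ N i j

  IsInverse : ∀ {n} → Matrix Carrier n n → Matrix Carrier n n → Set ℓ
  IsInverse M N = ((M ⊗ N) ≈ᴹ I) × ((N ⊗ M) ≈ᴹ I)

  -- Here r = n + 2; indices 0..r-1, the last index (paper's r) is `last`.
  module _ {n : ℕ} where
    last : Fin (suc (suc n))
    last = fromℕ (suc n)

    jfac : Matrix Carrier (suc (suc n)) (suc (suc n)) → (Fin (suc (suc n)) → Carrier) → Carrier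
    jfac γ z = ∑ (λ i → γ last i * z i)

    act : Matrix Carrier (suc (suc n)) (suc (suc n)) → (Fin (suc (suc n)) → Carrier) → Fin (suc (suc n)) → Carrier
    act γ z i = ∑ (λ k → γ i k * z k)

    frakC : Matrix Carrier (suc (suc n)) (suc (suc n)) → (Fin (suc (suc n)) → Carrier)
          → Matrix Carrier (suc n) (suc n)
    frakC γ z j l = cofactor γ (inject₁ j) (inject₁ l) - cofactor γ (inject₁ j) last * z (inject₁ l)

    -- z ∈ Ω^r relative to a subset K of the ring (standing for K_∞ ⊂ C_∞):
    -- z_r = 1 and the entries of z are K-linearly independent.
    InOmega : ∀ {k} → Pred Carrier k → (Fin (suc (suc n)) → Carrier) → Set (c ⊔ ℓ ⊔ k)
    InOmega K z = (z last ≈ 1#)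
      × (∀ (λs : Fin (suc (suc n)) → Carrier) → (∀ i → K (λs i))
           → ∑ (λ i → λs i * z i) ≈ 0# → ∀ i → λs i ≈ 0#)

IsField : ∀ {c ℓ} → CommutativeRing c ℓ → Set (c ⊔ ℓ)
IsField C = ¬ (1# ≈ 0#) × (∀ x → ¬ (x ≈ 0#) → Σ Carrier (λ y → x * y ≈ 1#))
  where open CommutativeRing C using (Carrier; _≈_; _*_; 0#; 1#)
        open import Data.Product using (Σ)

{-# OPTIONS --safe #-}
module Submission where

-- Work over an arbitrary commutative ring, with M = ι(γ) and N = ι(γ⁻¹). Starting from the first-row Laplace
-- expansion, determinants are developed far enough for the adjugate formula: an alternating multilinear function of
-- the rows is det times its value at I, so det is multiplicative and transpose invariant, and the cofactor matrix of
-- M is det M · Nᵀ. Hence 𝔠^γ_{jl}(z) = det M · (N_{lj} − N_{rj} z_l). The transpose of the bracketed matrix is the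
-- (r,r)-minor of Q = (I − z′e_rᵀ) N, where z′ is z with its last entry replaced by 0; Q has determinant det N and
-- inverse M (I + z′e_rᵀ), whose (r,r)-entry is Σ_l M_{rl} z_l = j(γ,z), so the adjugate formula gives (i).
-- For (ii), w · j(γ,z) = M z makes N w proportional to z, and w_r = z_r = 1; expanding 𝔆^{γ⁻¹}(w) 𝔆^γ(z) with the
-- same cofactor formula then reduces it to N M = I, and the other product is the same computation with (γ, z) and
-- (γ⁻¹, w) interchanged. Finally j(γ,z) ≠ 0, as the last row of γ is nonzero and z has K-independent entries.

open import Defs
open import Level using (Level; _⊔_)
open import Data.Nat as ℕ using (ℕ; zero; suc)
import Data.Nat.Properties as ℕ
open import Data.Integer as ℤ using (ℤ; +_; -[1+_]; 0ℤ)
import Data.Integer.Properties as ℤ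
open import Data.Sign as Sign using (Sign)
open import Data.Maybe using (Maybe; just; nothing)
open import Data.Fin as Fin using (Fin; zero; suc; toℕ; punchIn; punchOut; inject₁; fromℕ; _≟_)
import Data.Fin.Properties as Fin
open import Data.Vec.Functional using (Vector; updateAt; insertAt)
open import Data.Vec.Functional.Properties
  using ( updateAt-updates; updateAt-minimal; updateAt-updateAt; updateAt-id-local; updateAt-commutes
        ; map-updateAt; insertAt-lookup; insertAt-punchIn )
open import Data.Product using (_×_; _,_; proj₁; proj₂)
open import Data.Empty using (⊥; ⊥-elim)
open import Function using (_∘_; const)
open import Function.Definitions using (Injective)
open import Relation.Binary.Core using (Rel)
open import Relation.Binary.Definitions using (tri<; tri≈; tri>)
open import Relation.Binary.PropositionalEquality as ≡ using (_≡_; _≢_)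
open import Relation.Nullary using (Dec; yes; no)
open import Relation.Unary using (Pred)
open import Algebra.Bundles using (CommutativeRing)
open import Algebra.Morphism.Structures using (IsRingHomomorphism)
open import Algebra.Solver.Ring.AlmostCommutativeRing using (fromCommutativeRing; _-Raw-AlmostCommutative⟶_)

-- The ring solver of Algebra.Solver.Ring needs a coefficient ring mapping into R; ℤ does so for every R.
module IntegerCoefficients {c ℓ} (R : CommutativeRing c ℓ) where
  open CommutativeRing R
  open import Relation.Binary.Reasoning.Setoid setoid
  open import Algebra.Properties.Monoid.Mult +-monoid using (×-homo-1; ×-homo-+) renaming (_×_ to _×′_)
  open import Algebra.Properties.Semiring.Mult semiring using (×1-homo-*)
  open import Algebra.Properties.Ring ring using (-‿distribʳ-*; -0#≈0#; -‿+-comm; -‿involutive; -1*x≈-x)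
  open import Algebra.Properties.CommutativeSemigroup *-commutativeSemigroup using (x∙yz≈y∙xz)
  open import Algebra.Properties.AbelianGroup +-abelianGroup using (xyx⁻¹≈y)

  fromℤ : ℤ → Carrier
  fromℤ (+ n)      = n ×′ 1#
  fromℤ -[1+ n ]   = - (suc n ×′ 1#)

  private
    1+-cancel : ∀ a b → (1# + a) - (1# + b) ≈ a - b
    1+-cancel a b = begin
      (1# + a) - (1# + b)       ≈⟨ +-congˡ (-‿+-comm 1# b) ⟨
      (1# + a) + (- 1# - b)     ≈⟨ +-congˡ (+-comm _ _) ⟩
      (1# + a) + (- b - 1#)     ≈⟨ +-assoc _ _ _ ⟨
      ((1# + a) - b) - 1#       ≈⟨ +-congʳ (+-assoc _ _ _) ⟩
      (1# + (a - b)) - 1#       ≈⟨ xyx⁻¹≈y 1# (a - b) ⟩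
      a - b                     ∎

  ⊖-homo : ∀ m n → fromℤ (m ℤ.⊖ n) ≈ m ×′ 1# - n ×′ 1#
  ⊖-homo zero    zero    = sym (-‿inverseʳ 0#)
  ⊖-homo zero    (suc n) = sym (+-identityˡ _)
  ⊖-homo (suc m) zero    = sym (trans (+-congˡ -0#≈0#) (+-identityʳ _))
  ⊖-homo (suc m) (suc n) = begin
    fromℤ (suc m ℤ.⊖ suc n)      ≡⟨ ≡.cong fromℤ (ℤ.[1+m]⊖[1+n]≡m⊖n m n) ⟩
    fromℤ (m ℤ.⊖ n)              ≈⟨ ⊖-homo m n ⟩
    m ×′ 1# - n ×′ 1#            ≈⟨ 1+-cancel _ _ ⟨
    suc m ×′ 1# - suc n ×′ 1#    ∎

  +-homo : ∀ i j → fromℤ (i ℤ.+ j) ≈ fromℤ i + fromℤ j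
  +-homo (+ m)    (+ n)    = ×-homo-+ 1# m n
  +-homo (+ m)    -[1+ n ] = ⊖-homo m (suc n)
  +-homo -[1+ m ] (+ n)    = trans (⊖-homo n (suc m)) (+-comm _ _)
  +-homo -[1+ m ] -[1+ n ] = begin
    - (suc (suc (m ℕ.+ n)) ×′ 1#)      ≡⟨ ≡.cong (λ k → - (suc k ×′ 1#)) (ℕ.+-suc m n) ⟨
    - ((suc m ℕ.+ suc n) ×′ 1#)        ≈⟨ -‿cong (×-homo-+ 1# (suc m) (suc n)) ⟩
    - (suc m ×′ 1# + suc n ×′ 1#)      ≈⟨ -‿+-comm _ _ ⟨
    - (suc m ×′ 1#) + - (suc n ×′ 1#)  ∎

  -‿homo : ∀ i → fromℤ (ℤ.- i) ≈ - fromℤ i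
  -‿homo (+ zero)  = sym -0#≈0#
  -‿homo (+ suc n) = refl
  -‿homo -[1+ n ]  = sym (-‿involutive _)

  private
    ⟦_⟧ₛ : Sign → Carrier
    ⟦ Sign.+ ⟧ₛ = 1#
    ⟦ Sign.- ⟧ₛ = - 1#

    ◃-homo : ∀ s k → fromℤ (s ℤ.◃ k) ≈ ⟦ s ⟧ₛ * (k ×′ 1#)
    ◃-homo s      zero    = sym (zeroʳ _)
    ◃-homo Sign.+ (suc k) = sym (*-identityˡ _)
    ◃-homo Sign.- (suc k) = sym (-1*x≈-x _)

    sign-magnitude : ∀ i → fromℤ i ≈ ⟦ ℤ.sign i ⟧ₛ * (ℤ.∣ i ∣ ×′ 1#)
    sign-magnitude (+ n)    = sym (*-identityˡ _)
    sign-magnitude -[1+ n ] = sym (-1*x≈-x _)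

    ⟦⟧ₛ-homo : ∀ s t → ⟦ s Sign.* t ⟧ₛ ≈ ⟦ s ⟧ₛ * ⟦ t ⟧ₛ
    ⟦⟧ₛ-homo Sign.+ t      = sym (*-identityˡ _)
    ⟦⟧ₛ-homo Sign.- Sign.+ = sym (*-identityʳ _)
    ⟦⟧ₛ-homo Sign.- Sign.- = begin
      1#              ≈⟨ -‿involutive 1# ⟨
      - - 1#          ≈⟨ -‿cong (-1*x≈-x 1#) ⟨
      - (- 1# * 1#)   ≈⟨ -‿distribʳ-* _ _ ⟩
      - 1# * - 1#     ∎

  *-homo : ∀ i j → fromℤ (i ℤ.* j) ≈ fromℤ i * fromℤ j
  *-homo i j = begin
    fromℤ (i ℤ.* j)                                 ≈⟨ ◃-homo (s Sign.* t) (ℤ.∣ i ∣ ℕ.* ℤ.∣ j ∣) ⟩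
    ⟦ s Sign.* t ⟧ₛ * ((ℤ.∣ i ∣ ℕ.* ℤ.∣ j ∣) ×′ 1#)  ≈⟨ *-cong (⟦⟧ₛ-homo s t) (×1-homo-* ℤ.∣ i ∣ ℤ.∣ j ∣) ⟩
    (⟦ s ⟧ₛ * ⟦ t ⟧ₛ) * (x * y)                     ≈⟨ *-assoc _ _ _ ⟩
    ⟦ s ⟧ₛ * (⟦ t ⟧ₛ * (x * y))                     ≈⟨ *-congˡ (x∙yz≈y∙xz _ _ _) ⟩
    ⟦ s ⟧ₛ * (x * (⟦ t ⟧ₛ * y))                     ≈⟨ *-assoc _ _ _ ⟨
    (⟦ s ⟧ₛ * x) * (⟦ t ⟧ₛ * y)                     ≈⟨ *-cong (sign-magnitude i) (sign-magnitude j) ⟨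
    fromℤ i * fromℤ j                               ∎
    where s = ℤ.sign i; t = ℤ.sign j; x = ℤ.∣ i ∣ ×′ 1#; y = ℤ.∣ j ∣ ×′ 1#

  homomorphism : ℤ.+-*-rawRing -Raw-AlmostCommutative⟶ fromCommutativeRing R
  homomorphism = record
    { ⟦_⟧ = fromℤ ; +-homo = +-homo ; *-homo = *-homo ; -‿homo = -‿homo
    ; 0-homo = refl ; 1-homo = ×-homo-1 1# }

  fromℤ-≟ : ∀ i j → Maybe (fromℤ i ≈ fromℤ j)
  fromℤ-≟ i j with i ℤ.≟ j
  ... | yes ≡.refl = just refl
  ... | no _       = nothing

  open import Algebra.Solver.Ring ℤ.+-*-rawRing (fromCommutativeRing R) homomorphism fromℤ-≟ public


infixl 6 _[_]≔_
_[_]≔_ : ∀ {a} {X : Set a} {n} → Vector X n → Fin n → X → Vector X n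
xs [ i ]≔ x = updateAt xs i (const x)

[]≔-pointwise : ∀ {a r} {X : Set a} (_∼_ : Rel X r) {n} {xs ys : Vector X n} (i : Fin n) {x y : X}
              → x ∼ y → (∀ j → j ≢ i → xs j ∼ ys j) → ∀ j → (xs [ i ]≔ x) j ∼ (ys [ i ]≔ y) j
[]≔-pointwise _∼_ zero    x∼y rest zero    = x∼y
[]≔-pointwise _∼_ zero    x∼y rest (suc j) = rest (suc j) λ ()
[]≔-pointwise _∼_ (suc i) x∼y rest zero    = rest zero λ ()
[]≔-pointwise _∼_ (suc i) x∼y rest (suc j) =
  []≔-pointwise _∼_ i x∼y (λ k k≢i → rest (suc k) (k≢i ∘ Fin.suc-injective)) j

[]≔-punchIn : ∀ {a} {X : Set a} {m} (xs : Vector X (suc m)) x {j l : Fin (suc m)} (j≢l : j ≢ l) b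
            → (xs [ l ]≔ x) (punchIn j b) ≡ ((xs ∘ punchIn j) [ punchOut j≢l ]≔ x) b
[]≔-punchIn xs x {j} {l} j≢l b with b ≟ punchOut j≢l
... | yes ≡.refl = ≡.trans (≡.cong (xs [ l ]≔ x) (Fin.punchIn-punchOut j≢l))
                           (≡.trans (updateAt-updates l xs) (≡.sym (updateAt-updates b (xs ∘ punchIn j))))
... | no  b≢l′   = ≡.trans (updateAt-minimal _ l xs punchIn≢l) (≡.sym (updateAt-minimal b _ (xs ∘ punchIn j) b≢l′))
  where
  punchIn≢l : punchIn j b ≢ l
  punchIn≢l eq = b≢l′ (≡.sym (≡.trans (Fin.punchOut-cong j (≡.sym eq)) (Fin.punchOut-punchIn j)))

adjacentSwap : ∀ {n} → Fin n → Fin (suc n) → Fin (suc n)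
adjacentSwap zero    zero          = suc zero
adjacentSwap zero    (suc zero)    = zero
adjacentSwap zero    (suc (suc a)) = suc (suc a)
adjacentSwap (suc k) zero          = zero
adjacentSwap (suc k) (suc a)       = suc (adjacentSwap k a)

inject₁≢suc : ∀ {n} (k : Fin n) → inject₁ k ≢ suc k
inject₁≢suc zero    ()
inject₁≢suc (suc k) eq = inject₁≢suc k (Fin.suc-injective eq)

adjacentSwap-inject₁ : ∀ {n} (k : Fin n) → adjacentSwap k (inject₁ k) ≡ suc k
adjacentSwap-inject₁ zero    = ≡.refl
adjacentSwap-inject₁ (suc k) = ≡.cong suc (adjacentSwap-inject₁ k)

adjacentSwap-suc : ∀ {n} (k : Fin n) → adjacentSwap k (suc k) ≡ inject₁ k
adjacentSwap-suc zero    = ≡.refl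
adjacentSwap-suc (suc k) = ≡.cong suc (adjacentSwap-suc k)

adjacentSwap-other : ∀ {n} (k : Fin n) a → a ≢ inject₁ k → a ≢ suc k → adjacentSwap k a ≡ a
adjacentSwap-other zero    zero          a≢k a≢k+1 = ⊥-elim (a≢k ≡.refl)
adjacentSwap-other zero    (suc zero)    a≢k a≢k+1 = ⊥-elim (a≢k+1 ≡.refl)
adjacentSwap-other zero    (suc (suc a)) a≢k a≢k+1 = ≡.refl
adjacentSwap-other (suc k) zero          a≢k a≢k+1 = ≡.refl
adjacentSwap-other (suc k) (suc a)       a≢k a≢k+1 =
  ≡.cong suc (adjacentSwap-other k a (a≢k ∘ ≡.cong suc) (a≢k+1 ∘ ≡.cong suc))

adjacentSwap-punchIn : ∀ {n} (k : Fin n) a → adjacentSwap k (punchIn (inject₁ k) a) ≡ punchIn (suc k) a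
adjacentSwap-punchIn zero    zero    = ≡.refl
adjacentSwap-punchIn zero    (suc a) = ≡.refl
adjacentSwap-punchIn (suc k) zero    = ≡.refl
adjacentSwap-punchIn (suc k) (suc a) = ≡.cong suc (adjacentSwap-punchIn k a)

moveToFront : ∀ {a} {X : Set a} {m} → Fin (suc m) → Vector X (suc m) → Vector X (suc m)
moveToFront j xs zero    = xs j
moveToFront j xs (suc a) = xs (punchIn j a)

punchIn-fromℕ : ∀ {n} (a : Fin n) → punchIn (fromℕ n) a ≡ inject₁ a
punchIn-fromℕ zero    = ≡.refl
punchIn-fromℕ (suc a) = ≡.cong suc (punchIn-fromℕ a)

insertAt-pointwise : ∀ {a b r} {X : Set a} {Y : Set b} (_∼_ : X → Y → Set r) {n}
                     {xs : Vector X n} {ys : Vector Y n} (j : Fin (suc n)) {x y}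
                   → x ∼ y → (∀ b → xs b ∼ ys b) → ∀ c → insertAt xs j x c ∼ insertAt ys j y c
insertAt-pointwise _∼_         zero    x∼y xs∼ys zero    = x∼y
insertAt-pointwise _∼_         zero    x∼y xs∼ys (suc c) = xs∼ys c
insertAt-pointwise _∼_ {suc n} (suc j) x∼y xs∼ys zero    = xs∼ys zero
insertAt-pointwise _∼_ {suc n} (suc j) x∼y xs∼ys (suc c) = insertAt-pointwise _∼_ j x∼y (xs∼ys ∘ suc) c

insertAt-zipWith : ∀ {a b d} {X : Set a} {Y : Set b} {Z : Set d} (g : X → Y → Z) {n}
                   (xs : Vector X n) (ys : Vector Y n) j x y c
                 → insertAt (λ b → g (xs b) (ys b)) j (g x y) c ≡ g (insertAt xs j x c) (insertAt ys j y c)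
insertAt-zipWith g         xs ys zero    x y zero    = ≡.refl
insertAt-zipWith g         xs ys zero    x y (suc c) = ≡.refl
insertAt-zipWith g {suc n} xs ys (suc j) x y zero    = ≡.refl
insertAt-zipWith g {suc n} xs ys (suc j) x y (suc c) = insertAt-zipWith g (xs ∘ suc) (ys ∘ suc) j x y c

insertAt-punchOut : ∀ {a} {X : Set a} {n} (xs : Vector X n) {j c : Fin (suc n)} x (j≢c : j ≢ c)
                  → insertAt xs j x c ≡ xs (punchOut j≢c)
insertAt-punchOut xs {j} x j≢c =
  ≡.trans (≡.cong (insertAt xs j x) (≡.sym (Fin.punchIn-punchOut j≢c)))
          (insertAt-punchIn xs j x (punchOut j≢c))

module Matrices {c ℓ} (R : CommutativeRing c ℓ) where
  open CommutativeRing R hiding (zero)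
  open Lin R
  open IntegerCoefficients R using (solve; _:+_; _:*_; :-_; _:-_; _:=_; con)
  open import Relation.Binary.Reasoning.Setoid setoid
  open import Algebra.Properties.Group +-group using (inverseʳ-unique)
  open import Algebra.Properties.Ring ring using (-‿distribˡ-*; -‿distribʳ-*; -0#≈0#; -‿+-comm; -‿involutive)
  import Algebra.Properties.Semiring.Sum semiring as Sum
  open import Algebra.Properties.CommutativeSemigroup *-commutativeSemigroup using (x∙yz≈xz∙y)

  Mat : ℕ → Set c
  Mat n = Matrix Carrier n n

  ∑≈sum : ∀ {n} (f : Fin n → Carrier) → ∑ f ≈ Sum.sum f
  ∑≈sum {zero}  f = refl
  ∑≈sum {suc n} f = +-congˡ (∑≈sum (f ∘ suc))

  ∑-cong : ∀ {n} {f g : Fin n → Carrier} → (∀ i → f i ≈ g i) → ∑ f ≈ ∑ g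
  ∑-cong {f = f} {g} f≈g = trans (∑≈sum f) (trans (Sum.sum-cong-≋ f≈g) (sym (∑≈sum g)))

  ∑-distrib-+ : ∀ {n} (f g : Fin n → Carrier) → ∑ (λ i → f i + g i) ≈ ∑ f + ∑ g
  ∑-distrib-+ f g =
    trans (∑≈sum (λ i → f i + g i)) (trans (Sum.∑-distrib-+ f g) (sym (+-cong (∑≈sum f) (∑≈sum g))))

  *-distribˡ-∑ : ∀ {n} x (f : Fin n → Carrier) → x * ∑ f ≈ ∑ (λ i → x * f i)
  *-distribˡ-∑ x f =
    trans (*-congˡ (∑≈sum f)) (trans (Sum.*-distribˡ-sum x f) (sym (∑≈sum (λ i → x * f i))))

  *-distribʳ-∑ : ∀ {n} x (f : Fin n → Carrier) → ∑ f * x ≈ ∑ (λ i → f i * x)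
  *-distribʳ-∑ x f =
    trans (*-congʳ (∑≈sum f)) (trans (Sum.*-distribʳ-sum x f) (sym (∑≈sum (λ i → f i * x))))

  ∑-comm : ∀ {m n} (f : Fin m → Fin n → Carrier) → ∑ (λ i → ∑ (f i)) ≈ ∑ (λ j → ∑ (λ i → f i j))
  ∑-comm f = begin
    ∑ (λ i → ∑ (f i))
      ≈⟨ trans (∑≈sum (λ i → ∑ (f i))) (Sum.sum-cong-≋ λ i → ∑≈sum (f i)) ⟩
    Sum.sum (λ i → Sum.sum (f i))
      ≈⟨ Sum.∑-comm f ⟩
    Sum.sum (λ j → Sum.sum (λ i → f i j))
      ≈⟨ trans (∑≈sum (λ j → ∑ (λ i → f i j))) (Sum.sum-cong-≋ λ j → ∑≈sum (λ i → f i j)) ⟨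
    ∑ (λ j → ∑ (λ i → f i j))
      ∎

  ∑-init-last : ∀ {n} (f : Fin (suc n) → Carrier) → ∑ f ≈ ∑ (f ∘ inject₁) + f (fromℕ n)
  ∑-init-last f = trans (∑≈sum f) (trans (Sum.sum-init-last f) (+-congʳ (sym (∑≈sum (f ∘ inject₁)))))

  ∑-zero : ∀ {n} {f : Fin n → Carrier} → (∀ i → f i ≈ 0#) → ∑ f ≈ 0#
  ∑-zero {zero}  f≈0 = refl
  ∑-zero {suc n} f≈0 = trans (+-cong (f≈0 zero) (∑-zero (f≈0 ∘ suc))) (+-identityˡ 0#)

  ∑-neg : ∀ {n} (f : Fin n → Carrier) → ∑ (λ i → - f i) ≈ - ∑ f
  ∑-neg {zero}  f = sym -0#≈0#
  ∑-neg {suc n} f = trans (+-congˡ (∑-neg (f ∘ suc))) (-‿+-comm _ _)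

  ∑-distrib-- : ∀ {n} (f g : Fin n → Carrier) → ∑ (λ i → f i - g i) ≈ ∑ f - ∑ g
  ∑-distrib-- f g = trans (∑-distrib-+ f (λ i → - g i)) (+-congˡ (∑-neg g))

  ∑-single : ∀ {n} (f : Fin n → Carrier) i → (∀ j → j ≢ i → f j ≈ 0#) → ∑ f ≈ f i
  ∑-single f zero    others = trans (+-congˡ (∑-zero λ j → others (suc j) λ ())) (+-identityʳ _)
  ∑-single f (suc i) others = trans (+-cong (others zero λ ())
    (∑-single (f ∘ suc) i λ j j≢i → others (suc j) (j≢i ∘ Fin.suc-injective))) (+-identityˡ _)

  ∑-pair : ∀ {n} (f : Fin n → Carrier) i j → i ≢ j → (∀ k → k ≢ i → k ≢ j → f k ≈ 0#)
         → ∑ f ≈ f i + f j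
  ∑-pair f zero    zero    i≢j others = ⊥-elim (i≢j ≡.refl)
  ∑-pair f zero    (suc j) i≢j others =
    +-congˡ (∑-single (f ∘ suc) j λ k k≢j → others (suc k) (λ ()) (k≢j ∘ Fin.suc-injective))
  ∑-pair f (suc i) zero    i≢j others = trans
    (+-congˡ (∑-single (f ∘ suc) i λ k k≢i → others (suc k) (k≢i ∘ Fin.suc-injective) (λ ()))) (+-comm _ _)
  ∑-pair f (suc i) (suc j) i≢j others = trans (+-cong (others zero (λ ()) (λ ()))
    (∑-pair (f ∘ suc) i j (i≢j ∘ ≡.cong suc)
      λ k k≢i k≢j → others (suc k) (k≢i ∘ Fin.suc-injective) (k≢j ∘ Fin.suc-injective))) (+-identityˡ _)

  I-diag : ∀ {n} (i : Fin n) → I i i ≈ 1#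
  I-diag i with i ≟ i
  ... | yes _   = refl
  ... | no  i≢i = ⊥-elim (i≢i ≡.refl)

  I-off : ∀ {n} {i j : Fin n} → i ≢ j → I i j ≈ 0#
  I-off {i = i} {j} i≢j with i ≟ j
  ... | yes i≡j = ⊥-elim (i≢j i≡j)
  ... | no  _   = refl

  I-sym : ∀ {n} (i j : Fin n) → I i j ≈ I j i
  -- A `with` on i ≟ j would also abstract the same test inside I; case splits on I therefore go through a helper.
  I-sym i j = by-cases (i ≟ j)
    where
    by-cases : Dec (i ≡ j) → I i j ≈ I j i
    by-cases (yes ≡.refl) = refl
    by-cases (no i≢j)     = trans (I-off i≢j) (sym (I-off (i≢j ∘ ≡.sym)))

  I-injective : ∀ {m n} (φ : Fin m → Fin n) → Injective _≡_ _≡_ φ → ∀ a b → I (φ a) (φ b) ≈ I a b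
  I-injective φ φ-inj a b = by-cases (a ≟ b)
    where
    by-cases : Dec (a ≡ b) → I (φ a) (φ b) ≈ I a b
    by-cases (yes ≡.refl) = trans (I-diag (φ a)) (sym (I-diag a))
    by-cases (no a≢b)     = trans (I-off (a≢b ∘ φ-inj)) (sym (I-off a≢b))

  ∑-Iˡ : ∀ {n} (i : Fin n) (f : Fin n → Carrier) → ∑ (λ j → I i j * f j) ≈ f i
  ∑-Iˡ i f = trans (∑-single _ i λ j j≢i → trans (*-congʳ (I-off (j≢i ∘ ≡.sym))) (zeroˡ _))
                   (trans (*-congʳ (I-diag i)) (*-identityˡ _))

  ∑-Iʳ : ∀ {n} (i : Fin n) (f : Fin n → Carrier) → ∑ (λ j → f j * I j i) ≈ f i
  ∑-Iʳ i f = trans (∑-single _ i λ j j≢i → trans (*-congˡ (I-off j≢i)) (zeroʳ _))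
                   (trans (*-congˡ (I-diag i)) (*-identityʳ _))

  _≋_ : ∀ {n} → Vector Carrier n → Vector Carrier n → Set ℓ
  u ≋ v = ∀ k → u k ≈ v k

  ≡-rows⇒≈ᴹ : ∀ {m n} {M N : Matrix Carrier m n} → (∀ a → M a ≡ N a) → M ≈ᴹ N
  ≡-rows⇒≈ᴹ M≡N a b = reflexive (≡.cong (λ row → row b) (M≡N a))

  []≔-cong : ∀ {m n} {M N : Matrix Carrier m n} i {u v} → u ≋ v → (∀ a → a ≢ i → M a ≋ N a)
           → (M [ i ]≔ u) ≈ᴹ (N [ i ]≔ v)
  []≔-cong = []≔-pointwise _≋_

  -- Alternating multilinear functions and the determinant

  Congruent : ∀ {m} → (Mat m → Carrier) → Set (c ⊔ ℓ)
  Congruent f = ∀ {M N} → M ≈ᴹ N → f M ≈ f N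

  Additive : ∀ {m} → (Mat m → Carrier) → Set (c ⊔ ℓ)
  Additive {m} f = ∀ M i (u v : Vector Carrier m)
                 → f (M [ i ]≔ (λ k → u k + v k)) ≈ f (M [ i ]≔ u) + f (M [ i ]≔ v)

  Homogeneous : ∀ {m} → (Mat m → Carrier) → Set (c ⊔ ℓ)
  Homogeneous {m} f = ∀ M i x (u : Vector Carrier m)
                    → f (M [ i ]≔ (λ k → x * u k)) ≈ x * f (M [ i ]≔ u)

  Alternating : ∀ {m} → (Mat m → Carrier) → Set (c ⊔ ℓ)
  Alternating f = ∀ M i j → i ≢ j → M i ≋ M j → f M ≈ 0#

  record IsAlternatingMultilinear {m} (f : Mat m → Carrier) : Set (c ⊔ ℓ) where
    field
      cong        : Congruent f
      additive    : Additive f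
      homogeneous : Homogeneous f
      alternating : Alternating f

  module FromAdjacentAlternation {n} (f : Mat (suc n) → Carrier) (f-cong : Congruent f) (additive : Additive f)
    (adjacent : ∀ M k → M (inject₁ k) ≋ M (suc k) → f M ≈ 0#) where

    adjacentSwap-negates : ∀ M k → f (M ∘ adjacentSwap k) ≈ - f M
    adjacentSwap-negates M k = trans (f-cong (≡-rows⇒≈ᴹ swapped-rows)) (inverseʳ-unique (f M) (S v u) (begin
      f M + S v u                                     ≈⟨ +-cong S-orig (+-identityʳ _) ⟨
      S u v + (S v u + 0#)                            ≈⟨ +-cong (+-identityˡ _) (+-congˡ (S-equal v)) ⟨
      (0# + S u v) + (S v u + S v v)                  ≈⟨ +-congʳ (+-congʳ (S-equal u)) ⟨
      (S u u + S u v) + (S v u + S v v)               ≈⟨ +-cong (additive _ j u v) (additive _ j u v) ⟨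
      S u (λ c → u c + v c) + S v (λ c → u c + v c)   ≈⟨ S-additiveˡ u v _ ⟨
      S (λ c → u c + v c) (λ c → u c + v c)           ≈⟨ S-equal _ ⟩
      0#                                              ∎))
      where
      i j : Fin (suc n)
      i = inject₁ k
      j = suc k
      u = M i
      v = M j
      S : Vector Carrier (suc n) → Vector Carrier (suc n) → Carrier
      S x y = f (M [ i ]≔ x [ j ]≔ y)
      S-equal : ∀ w → S w w ≈ 0#
      S-equal w = adjacent _ k λ c → reflexive (≡.cong (λ row → row c) (≡.trans
        (updateAt-minimal i j (M [ i ]≔ w) (inject₁≢suc k))
        (≡.trans (updateAt-updates i M) (≡.sym (updateAt-updates j (M [ i ]≔ w))))))
      S-additiveˡ : ∀ x y w → S (λ c → x c + y c) w ≈ S x w + S y w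
      S-additiveˡ x y w = begin
        S (λ c → x c + y c) w                              ≈⟨ f-cong (swap-updates (inject₁≢suc k ∘ ≡.sym)) ⟩
        f (M [ j ]≔ w [ i ]≔ (λ c → x c + y c))            ≈⟨ additive _ i x y ⟩
        f (M [ j ]≔ w [ i ]≔ x) + f (M [ j ]≔ w [ i ]≔ y)  ≈⟨ +-cong (f-cong (swap-updates (inject₁≢suc k)))
                                                                     (f-cong (swap-updates (inject₁≢suc k))) ⟩
        S x w + S y w                                      ∎
        where
        swap-updates : ∀ {a b x y} → a ≢ b → (M [ b ]≔ x [ a ]≔ y) ≈ᴹ (M [ a ]≔ y [ b ]≔ x)
        swap-updates {a} {b} a≢b = ≡-rows⇒≈ᴹ (updateAt-commutes a b a≢b M)
      S-orig : S u v ≈ f M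
      S-orig = f-cong (≡-rows⇒≈ᴹ λ a → ≡.trans
        (updateAt-id-local j (M [ i ]≔ u) (≡.sym (updateAt-minimal j i M (inject₁≢suc k ∘ ≡.sym))) a)
        (updateAt-id-local i M ≡.refl a))
      swapped-rows : ∀ a → M (adjacentSwap k a) ≡ (M [ i ]≔ v [ j ]≔ u) a
      swapped-rows a with a ≟ j | a ≟ i
      ... | yes ≡.refl | _          = ≡.trans (≡.cong M (adjacentSwap-suc k))
                                              (≡.sym (updateAt-updates j (M [ i ]≔ v)))
      ... | no a≢j     | yes ≡.refl = ≡.trans (≡.cong M (adjacentSwap-inject₁ k)) (≡.sym
                                        (≡.trans (updateAt-minimal a j (M [ i ]≔ v) a≢j) (updateAt-updates i M)))
      ... | no a≢j     | no a≢i     = ≡.trans (≡.cong M (adjacentSwap-other k a a≢i a≢j)) (≡.sym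
                                        (≡.trans (updateAt-minimal a j (M [ i ]≔ v) a≢j) (updateAt-minimal a i M a≢i)))

    private
      alternating-at-distance : ∀ d M (i j : Fin (suc n)) → toℕ j ≡ d → toℕ i ℕ.< toℕ j → M i ≋ M j
                              → f M ≈ 0#
      alternating-at-distance d       M i zero    _   ()  _
      alternating-at-distance zero    M i (suc k) ()  _   _
      alternating-at-distance (suc d) M i (suc k) j≡d i<j Mi≋Mj with toℕ i ℕ.≟ toℕ k
      ... | yes i≡k = adjacent M k (≡.subst (λ i → M i ≋ M (suc k)) i≡inject₁k Mi≋Mj)
        where
        i≡inject₁k : i ≡ inject₁ k
        i≡inject₁k = Fin.toℕ-injective (≡.trans i≡k (≡.sym (Fin.toℕ-inject₁ k)))
      ... | no  i≢k = begin
        f M                ≈⟨ -‿involutive (f M) ⟨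
        - - f M            ≈⟨ -‿cong (adjacentSwap-negates M k) ⟨
        - f M′             ≈⟨ -‿cong (alternating-at-distance d M′ i (inject₁ k) k≡d i<k M′i≋M′k) ⟩
        - 0#               ≈⟨ -0#≈0# ⟩
        0#                 ∎
        where
        M′ = M ∘ adjacentSwap k
        i≢inject₁k : i ≢ inject₁ k
        i≢inject₁k i≡k′ = i≢k (≡.trans (≡.cong toℕ i≡k′) (Fin.toℕ-inject₁ k))
        i≢suc-k : i ≢ suc k
        i≢suc-k i≡k+1 = ℕ.<-irrefl (≡.cong toℕ i≡k+1) i<j
        k≡d : toℕ (inject₁ k) ≡ d
        k≡d = ≡.trans (Fin.toℕ-inject₁ k) (ℕ.suc-injective j≡d)
        i<k : toℕ i ℕ.< toℕ (inject₁ k)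
        i<k = ≡.subst (toℕ i ℕ.<_) (≡.sym (Fin.toℕ-inject₁ k)) (ℕ.≤∧≢⇒< (ℕ.≤-pred i<j) i≢k)
        M′i≋M′k : M′ i ≋ M′ (inject₁ k)
        M′i≋M′k c = trans (reflexive (≡.cong (λ a → M a c) (adjacentSwap-other k i i≢inject₁k i≢suc-k)))
                   (trans (Mi≋Mj c) (reflexive (≡.cong (λ a → M a c) (≡.sym (adjacentSwap-inject₁ k)))))

    alternating : Alternating f
    alternating M i j i≢j Mi≋Mj with ℕ.<-cmp (toℕ i) (toℕ j)
    ... | tri< i<j _ _ = alternating-at-distance _ M i j ≡.refl i<j Mi≋Mj
    ... | tri≈ _ i≡j _ = ⊥-elim (i≢j (Fin.toℕ-injective i≡j))
    ... | tri> _ _ j<i = alternating-at-distance _ M j i ≡.refl j<i (λ c → sym (Mi≋Mj c))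

    private
      moveToFront-sign-at : ∀ d M (j : Fin (suc n)) → toℕ j ≡ d → f (moveToFront j M) ≈ sign (toℕ j) * f M
      moveToFront-sign-at _       M zero    _   =
        trans (f-cong (≡-rows⇒≈ᴹ λ { zero → ≡.refl ; (suc a) → ≡.refl })) (sym (*-identityˡ _))
      moveToFront-sign-at zero    M (suc k) ()
      moveToFront-sign-at (suc d) M (suc k) j≡d = begin
        f (moveToFront (suc k) M)       ≈⟨ f-cong (≡-rows⇒≈ᴹ λ { zero    → ≡.cong M (≡.sym (adjacentSwap-inject₁ k))
                                                                ; (suc a) → ≡.cong M (≡.sym (adjacentSwap-punchIn k a)) }) ⟩
        f (moveToFront (inject₁ k) M′)  ≈⟨ moveToFront-sign-at d M′ (inject₁ k) k≡d ⟩
        sign (toℕ (inject₁ k)) * f M′   ≈⟨ *-cong (reflexive (≡.cong sign (Fin.toℕ-inject₁ k))) (adjacentSwap-negates M k) ⟩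
        sign (toℕ k) * - f M            ≈⟨ -‿distribʳ-* _ _ ⟨
        - (sign (toℕ k) * f M)          ≈⟨ -‿distribˡ-* _ _ ⟩
        - sign (toℕ k) * f M            ∎
        where
        M′ = M ∘ adjacentSwap k
        k≡d : toℕ (inject₁ k) ≡ d
        k≡d = ≡.trans (Fin.toℕ-inject₁ k) (ℕ.suc-injective j≡d)

    moveToFront-sign : ∀ M j → f (moveToFront j M) ≈ sign (toℕ j) * f M
    moveToFront-sign M j = moveToFront-sign-at _ M j ≡.refl

  invariant-under-zeroing : ∀ {n} (G : Vector Carrier n → Carrier) → (∀ {s t} → s ≋ t → G s ≈ G t)
                          → (∀ t a → G t ≈ G (t [ a ]≔ 0#)) → ∀ t → G t ≈ G (const 0#)
  invariant-under-zeroing {zero}  G G-cong G-inv t = G-cong λ ()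
  invariant-under-zeroing {suc n} G G-cong G-inv t = begin
    G t                  ≈⟨ G-inv t zero ⟩
    G (t [ zero ]≔ 0#)   ≈⟨ G-cong (λ { zero → refl ; (suc a) → refl }) ⟩
    G′ (t ∘ suc)         ≈⟨ invariant-under-zeroing G′ (G-cong ∘ cons0-cong) G′-inv (t ∘ suc) ⟩
    G′ (const 0#)        ≈⟨ G-cong (λ { zero → refl ; (suc a) → refl }) ⟩
    G (const 0#)         ∎
    where
    G′ : Vector Carrier n → Carrier
    G′ s = G (insertAt s zero 0#)
    cons0-cong : ∀ {s t} → s ≋ t → insertAt s zero 0# ≋ insertAt t zero 0#
    cons0-cong s≋t zero    = refl
    cons0-cong s≋t (suc a) = s≋t a
    G′-inv : ∀ s a → G′ s ≈ G′ (s [ a ]≔ 0#)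
    G′-inv s a = trans (G-inv _ (suc a)) (G-cong λ { zero → refl ; (suc b) → refl })

  addRowMultiples : ∀ {m} → Mat m → Fin m → Vector Carrier m → Mat m
  addRowMultiples Q p t a c = Q a c + t a * Q p c

  addRowMultiples-cong : ∀ {m} (Q : Mat m) p {s t} → s ≋ t
                       → addRowMultiples Q p s ≈ᴹ addRowMultiples Q p t
  addRowMultiples-cong Q p s≋t a c = +-congˡ (*-congʳ (s≋t a))

  addRowMultiples-peel : ∀ {m} (Q : Mat m) {a p} (t : Vector Carrier m) → a ≢ p → t p ≈ 0#
                       → let Q′ = addRowMultiples Q p (t [ a ]≔ 0#)
                         in addRowMultiples Q p t ≈ᴹ (Q′ [ a ]≔ (λ c → Q′ a c + t a * Q′ p c))
  addRowMultiples-peel Q {a} {p} t a≢p tp≈0 b c with b ≟ a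
  ... | yes ≡.refl = begin
    Q b c + t b * Q p c
      ≈⟨ solve 3 (λ x y z → x :+ y :* z := (x :+ con 0ℤ :* z) :+ y :* (z :+ con 0ℤ :* z)) refl (Q b c) (t b) (Q p c) ⟩
    (Q b c + 0# * Q p c) + t b * (Q p c + 0# * Q p c)
      ≈⟨ +-cong (+-congˡ (*-congʳ (reflexive (updateAt-updates b t)))) (*-congˡ (+-congˡ (*-congʳ t′p≈0))) ⟨
    Q′ b c + t b * Q′ p c
      ≡⟨ ≡.cong (λ row → row c) (updateAt-updates b Q′) ⟨
    (Q′ [ b ]≔ (λ c → Q′ b c + t b * Q′ p c)) b c
      ∎
    where
    Q′ = addRowMultiples Q p (t [ b ]≔ 0#)
    t′p≈0 : (t [ b ]≔ 0#) p ≈ 0#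
    t′p≈0 = trans (reflexive (updateAt-minimal p b t (a≢p ∘ ≡.sym))) tp≈0
  ... | no  b≢a    = reflexive (≡.sym (≡.trans (≡.cong (λ row → row c) (updateAt-minimal b a Q′ b≢a))
                                               (≡.cong (λ x → Q b c + x * Q p c) (updateAt-minimal b a t b≢a))))
    where Q′ = addRowMultiples Q p (t [ a ]≔ 0#)

  module AlternatingMultilinear {m} {f : Mat m → Carrier} (isAM : IsAlternatingMultilinear f) where
    open IsAlternatingMultilinear isAM

    row-linear : ∀ {k} M i (x : Vector Carrier k) (v : Fin k → Vector Carrier m)
               → f (M [ i ]≔ (λ c → ∑ (λ j → x j * v j c))) ≈ ∑ (λ j → x j * f (M [ i ]≔ v j))
    row-linear {zero}  M i x v = begin
      f (M [ i ]≔ (λ c → 0#))             ≈⟨ cong ([]≔-cong i (λ c → sym (zeroˡ 0#)) (λ _ _ _ → refl)) ⟩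
      f (M [ i ]≔ (λ c → 0# * 0#))        ≈⟨ homogeneous M i 0# (const 0#) ⟩
      0# * f (M [ i ]≔ const 0#)          ≈⟨ zeroˡ _ ⟩
      0#                                  ∎
    row-linear {suc k} M i x v = begin
      f (M [ i ]≔ (λ c → x zero * v zero c + ∑ (λ j → x (suc j) * v (suc j) c)))
        ≈⟨ additive M i _ _ ⟩
      f (M [ i ]≔ (λ c → x zero * v zero c)) + f (M [ i ]≔ (λ c → ∑ (λ j → x (suc j) * v (suc j) c)))
        ≈⟨ +-cong (homogeneous M i (x zero) (v zero)) (row-linear M i (x ∘ suc) (v ∘ suc)) ⟩
      x zero * f (M [ i ]≔ v zero) + ∑ (λ j → x (suc j) * f (M [ i ]≔ v (suc j)))
        ∎

    add-multiple-of-row : ∀ Q a p x → a ≢ p → f (Q [ a ]≔ (λ c → Q a c + x * Q p c)) ≈ f Q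
    add-multiple-of-row Q a p x a≢p = begin
      f (Q [ a ]≔ (λ c → Q a c + x * Q p c))             ≈⟨ additive Q a (Q a) (λ c → x * Q p c) ⟩
      f (Q [ a ]≔ Q a) + f (Q [ a ]≔ (λ c → x * Q p c))  ≈⟨ +-cong (cong (≡-rows⇒≈ᴹ (updateAt-id-local a Q ≡.refl)))
                                                                   (homogeneous Q a x (Q p)) ⟩
      f Q + x * f (Q [ a ]≔ Q p)                         ≈⟨ +-congˡ (*-congˡ (alternating _ a p a≢p rows-equal)) ⟩
      f Q + x * 0#                                       ≈⟨ trans (+-congˡ (zeroʳ x)) (+-identityʳ _) ⟩
      f Q                                                ∎
      where
      rows-equal : (Q [ a ]≔ Q p) a ≋ (Q [ a ]≔ Q p) p
      rows-equal c = reflexive (≡.cong (λ row → row c)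
        (≡.trans (updateAt-updates a Q) (≡.sym (updateAt-minimal p a Q (a≢p ∘ ≡.sym)))))

    add-multiples-of-row : ∀ Q p (t : Vector Carrier m) → t p ≈ 0# → f (addRowMultiples Q p t) ≈ f Q
    add-multiples-of-row Q p t tp≈0 = begin
      f (addRowMultiples Q p t)  ≈⟨ cong (addRowMultiples-cong Q p t≋masked) ⟩
      G t                        ≈⟨ invariant-under-zeroing G (cong ∘ addRowMultiples-cong Q p ∘ masked-cong) G-inv t ⟩
      G (const 0#)               ≈⟨ cong (λ a c → trans (+-congˡ (trans (*-congʳ (masked-zero a)) (zeroˡ _)))
                                                        (+-identityʳ _)) ⟩
      f Q                        ∎
      where
      masked : Vector Carrier m → Vector Carrier m
      masked s = s [ p ]≔ 0#
      masked-cong : ∀ {s t} → s ≋ t → masked s ≋ masked t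
      masked-cong {s} {t} s≋t = []≔-pointwise _≈_ {xs = s} {t} p (refl {0#}) (λ a _ → s≋t a)
      masked-zero : ∀ a → masked (const 0#) a ≈ 0#
      masked-zero = []≔-pointwise (λ x _ → x ≈ 0#) {ys = const 0#} p {y = 0#} refl (λ _ _ → refl)
      t≋masked : t ≋ masked t
      t≋masked k = trans (reflexive (≡.sym (updateAt-id-local p t ≡.refl k)))
                         ([]≔-pointwise _≈_ p tp≈0 (λ _ _ → refl) k)
      G : Vector Carrier m → Carrier
      G s = f (addRowMultiples Q p (masked s))
      G-inv : ∀ s a → G s ≈ G (s [ a ]≔ 0#)
      G-inv s a with a ≟ p
      ... | yes ≡.refl = cong (addRowMultiples-cong Q a λ b → reflexive (≡.sym (updateAt-updateAt a s b)))
      ... | no  a≢p    = begin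
        G s
          ≈⟨ cong (addRowMultiples-peel Q (masked s) a≢p (reflexive (updateAt-updates p s))) ⟩
        f (Q′ [ a ]≔ (λ c → Q′ a c + masked s a * Q′ p c))
          ≈⟨ add-multiple-of-row Q′ a p (masked s a) a≢p ⟩
        f Q′
          ≈⟨ cong (addRowMultiples-cong Q p λ b → reflexive (updateAt-commutes a p a≢p s b)) ⟩
        G (s [ a ]≔ 0#)
          ∎
        where Q′ = addRowMultiples Q p (masked s [ a ]≔ 0#)

  bordered : ∀ {m} → Fin (suc m) → Mat m → Mat (suc m)
  bordered j N zero    = I j
  bordered j N (suc a) = insertAt (N a) j 0#

  bordered-[]≔ : ∀ {m} (j : Fin (suc m)) N i w
               → bordered j (N [ i ]≔ w) ≈ᴹ (bordered j N [ suc i ]≔ insertAt w j 0#)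
  bordered-[]≔ j N i w zero    c = refl
  bordered-[]≔ j N i w (suc a) c = reflexive (≡.cong (λ row → row c)
    (map-updateAt {f = λ row → insertAt row j 0#} {g = const w} {h = const (insertAt w j 0#)}
                  (λ _ → ≡.refl) N i a))

  bordered-I : ∀ {m} (j : Fin (suc m)) → bordered j I ≈ᴹ moveToFront j I
  bordered-I j zero    c = refl
  bordered-I j (suc a) c with j ≟ c
  ... | yes ≡.refl = trans (reflexive (insertAt-lookup (I a) j 0#)) (sym (I-off (Fin.punchInᵢ≢i j a)))
  ... | no  j≢c    = begin
    insertAt (I a) j 0# c                        ≡⟨ insertAt-punchOut (I a) 0# j≢c ⟩
    I a (punchOut j≢c)                           ≈⟨ I-injective (punchIn j) (Fin.punchIn-injective j _ _) a _ ⟨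
    I (punchIn j a) (punchIn j (punchOut j≢c))   ≡⟨ ≡.cong (I (punchIn j a)) (Fin.punchIn-punchOut j≢c) ⟩
    I (punchIn j a) c                            ∎

  module _ {m} {f : Mat (suc m) → Carrier} (isAM : IsAlternatingMultilinear f) (j : Fin (suc m)) where
    open IsAlternatingMultilinear isAM

    bordered-isAlternatingMultilinear : IsAlternatingMultilinear (f ∘ bordered j)
    bordered-isAlternatingMultilinear = record
      { cong        = λ M≈N → cong λ { zero c → refl ; (suc a) → insertAt-pointwise _≈_ j refl (M≈N a) }
      ; additive    = λ N i u v → begin
          f (bordered j (N [ i ]≔ (λ k → u k + v k)))
            ≈⟨ cong (bordered-[]≔ j N i _) ⟩
          f (bordered j N [ suc i ]≔ insertAt (λ k → u k + v k) j 0#)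
            ≈⟨ cong ([]≔-cong (suc i) (λ c → trans (insertAt-pointwise _≈_ j (sym (+-identityʳ 0#)) (λ _ → refl) c)
                                                  (reflexive (insertAt-zipWith _+_ u v j 0# 0# c)))
                                     (λ _ _ _ → refl)) ⟩
          f (bordered j N [ suc i ]≔ (λ c → insertAt u j 0# c + insertAt v j 0# c))
            ≈⟨ additive _ (suc i) _ _ ⟩
          f (bordered j N [ suc i ]≔ insertAt u j 0#) + f (bordered j N [ suc i ]≔ insertAt v j 0#)
            ≈⟨ +-cong (cong (bordered-[]≔ j N i u)) (cong (bordered-[]≔ j N i v)) ⟨
          f (bordered j (N [ i ]≔ u)) + f (bordered j (N [ i ]≔ v))
            ∎
      ; homogeneous = λ N i x u → begin
          f (bordered j (N [ i ]≔ (λ k → x * u k)))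
            ≈⟨ cong (bordered-[]≔ j N i _) ⟩
          f (bordered j N [ suc i ]≔ insertAt (λ k → x * u k) j 0#)
            ≈⟨ cong ([]≔-cong (suc i) (λ c → trans (insertAt-pointwise _≈_ j (sym (zeroʳ x)) (λ _ → refl) c)
                                                   (reflexive (insertAt-zipWith (λ _ b → x * b) u u j 0# 0# c)))
                                      (λ _ _ _ → refl)) ⟩
          f (bordered j N [ suc i ]≔ (λ c → x * insertAt u j 0# c))
            ≈⟨ homogeneous _ (suc i) x _ ⟩
          x * f (bordered j N [ suc i ]≔ insertAt u j 0#)
            ≈⟨ *-congˡ (cong (bordered-[]≔ j N i u)) ⟨
          x * f (bordered j (N [ i ]≔ u))
            ∎
      ; alternating = λ N i i′ i≢i′ Ni≋Ni′ →
          alternating _ (suc i) (suc i′) (i≢i′ ∘ Fin.suc-injective) (insertAt-pointwise _≈_ j refl Ni≋Ni′)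
      }

  unit-first-row-clears-column : ∀ {m} {f : Mat (suc m) → Carrier} → IsAlternatingMultilinear f
                               → ∀ M j → f (M [ zero ]≔ I j) ≈ f (bordered j (minor zero j M))
  unit-first-row-clears-column {m} {f} isAM M j = begin
    f P                              ≈⟨ add-multiples-of-row P zero t refl ⟨
    f (addRowMultiples P zero t)     ≈⟨ cong cleared ⟩
    f (bordered j (minor zero j M))  ∎
    where
    open IsAlternatingMultilinear isAM using (cong)
    open AlternatingMultilinear isAM using (add-multiples-of-row)
    P = M [ zero ]≔ I j
    t : Vector Carrier (suc m)
    t zero    = 0#
    t (suc a) = - M (suc a) j
    cleared : addRowMultiples P zero t ≈ᴹ bordered j (minor zero j M)
    cleared zero    c = trans (+-congˡ (zeroˡ _)) (+-identityʳ _)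
    cleared (suc a) c = by-cases (j ≟ c)
      where
      by-cases : Dec (j ≡ c) → M (suc a) c + - M (suc a) j * I j c ≈ insertAt (minor zero j M a) j 0# c
      by-cases (yes ≡.refl) = begin
        M (suc a) j + - M (suc a) j * I j j   ≈⟨ +-congˡ (trans (*-congˡ (I-diag j)) (*-identityʳ _)) ⟩
        M (suc a) j - M (suc a) j             ≈⟨ -‿inverseʳ _ ⟩
        0#                                    ≡⟨ insertAt-lookup (minor zero j M a) j 0# ⟨
        insertAt (minor zero j M a) j 0# j    ∎
      by-cases (no j≢c) = begin
        M (suc a) c + - M (suc a) j * I j c   ≈⟨ +-congˡ (trans (*-congˡ (I-off j≢c)) (zeroʳ _)) ⟩
        M (suc a) c + 0#                      ≈⟨ +-identityʳ _ ⟩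
        M (suc a) c                           ≡⟨ ≡.cong (M (suc a)) (Fin.punchIn-punchOut j≢c) ⟨
        minor zero j M a (punchOut j≢c)       ≡⟨ insertAt-punchOut (minor zero j M a) 0# j≢c ⟨
        insertAt (minor zero j M a) j 0# c    ∎

  det-universal : ∀ {n} {f : Mat n → Carrier} → IsAlternatingMultilinear f → ∀ M → f M ≈ det M * f I
  det-universal {zero}      isAM M = trans (IsAlternatingMultilinear.cong isAM λ ()) (sym (*-identityˡ _))
  det-universal {suc m} {f} isAM M = begin
    f M                                                  ≈⟨ cong first-row-in-unit-basis ⟩
    f (M [ zero ]≔ (λ c → ∑ (λ j → M zero j * I j c)))   ≈⟨ row-linear M zero (M zero) I ⟩
    ∑ (λ j → M zero j * f (M [ zero ]≔ I j))             ≈⟨ ∑-cong (λ j → *-congˡ {M zero j} (unit-first-row j)) ⟩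
    ∑ (λ j → M zero j * (det (minor zero j M) * (sign (toℕ j) * f I)))
      ≈⟨ ∑-cong (λ j → solve 4 (λ a d s y → a :* (d :* (s :* y)) := s :* (a :* d) :* y) refl
                                (M zero j) (det (minor zero j M)) (sign (toℕ j)) (f I)) ⟩
    ∑ (λ j → sign (toℕ j) * (M zero j * det (minor zero j M)) * f I)
      ≈⟨ *-distribʳ-∑ (f I) (λ j → sign (toℕ j) * (M zero j * det (minor zero j M))) ⟨
    det M * f I                                          ∎
    where
    open IsAlternatingMultilinear isAM
    open AlternatingMultilinear isAM
    open FromAdjacentAlternation f cong additive (λ M k → alternating M (inject₁ k) (suc k) (inject₁≢suc k))
      using (moveToFront-sign)
    first-row-in-unit-basis : M ≈ᴹ (M [ zero ]≔ (λ c → ∑ (λ j → M zero j * I j c)))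
    first-row-in-unit-basis zero    c = sym (∑-Iʳ c (M zero))
    first-row-in-unit-basis (suc a) c = refl
    unit-first-row : ∀ j → f (M [ zero ]≔ I j) ≈ det (minor zero j M) * (sign (toℕ j) * f I)
    unit-first-row j = begin
      f (M [ zero ]≔ I j)
        ≈⟨ unit-first-row-clears-column isAM M j ⟩
      f (bordered j (minor zero j M))
        ≈⟨ det-universal (bordered-isAlternatingMultilinear isAM j) (minor zero j M) ⟩
      det (minor zero j M) * f (bordered j I)
        ≈⟨ *-congˡ (trans (cong (bordered-I j)) (moveToFront-sign I j)) ⟩
      det (minor zero j M) * (sign (toℕ j) * f I)
        ∎

  infix 30 _ᵀ
  _ᵀ : ∀ {m n} → Matrix Carrier m n → Matrix Carrier n m
  (M ᵀ) a b = M b a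

  det-cong : ∀ {n} {M N : Mat n} → M ≈ᴹ N → det M ≈ det N
  det-cong {zero}  M≈N = refl
  det-cong {suc n} M≈N = ∑-cong λ j →
    *-congˡ {sign (toℕ j)} (*-cong (M≈N zero j) (det-cong λ a b → M≈N (suc a) (punchIn j b)))

  det-I : ∀ {n} → det (I {n}) ≈ 1#
  det-I {zero}  = refl
  det-I {suc n} = begin
    det (I {suc n})                                ≈⟨ ∑-single term zero off-diagonal ⟩
    1# * (I₁ zero zero * det (minor zero zero I₁))  ≈⟨ *-identityˡ _ ⟩
    I₁ zero zero * det (minor zero zero I₁)         ≈⟨ *-cong (I-diag {suc n} zero)
                                                              (trans (det-cong {n} (I-injective suc Fin.suc-injective)) (det-I {n})) ⟩
    1# * 1#                                        ≈⟨ *-identityˡ _ ⟩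
    1#                                             ∎
    where
    I₁ = I {suc n}
    term : Fin (suc n) → Carrier
    term j = sign (toℕ j) * (I₁ zero j * det (minor zero j I₁))
    off-diagonal : ∀ j → j ≢ zero → term j ≈ 0#
    off-diagonal j j≢0 = trans (*-congˡ (trans (*-congʳ (I-off (j≢0 ∘ ≡.sym))) (zeroˡ _))) (zeroʳ _)

  minor-[]≔-same : ∀ {m} (M : Mat (suc m)) j w → minor j zero (M [ j ]≔ w) ≈ᴹ minor j zero M
  minor-[]≔-same M j w a b =
    reflexive (≡.cong (λ row → row (suc b)) (updateAt-minimal _ j M (Fin.punchInᵢ≢i j a)))

  minor-[]≔-other : ∀ {m} (M : Mat (suc m)) {j l} (j≢l : j ≢ l) w
                  → minor j zero (M [ l ]≔ w) ≈ᴹ (minor j zero M [ punchOut j≢l ]≔ (w ∘ suc))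
  minor-[]≔-other M j≢l w a b = reflexive (≡.trans (≡.cong (λ row → row (suc b)) ([]≔-punchIn M w j≢l a))
    (≡.cong (λ row → row b) (map-updateAt {f = λ row → row ∘ suc} {g = const w} {h = const (w ∘ suc)}
                                          (λ _ → ≡.refl) _ _ a)))

  private
    columnTerm : ∀ {m} → Mat (suc m) → Fin (suc m) → Carrier
    columnTerm X j = sign (toℕ j) * (X j zero * det (minor j zero X ᵀ))

  detᵀ-linear : ∀ {n} (M : Mat n) l x y (u v : Vector Carrier n)
              → det ((M [ l ]≔ (λ k → x * u k + y * v k)) ᵀ)
                ≈ x * det ((M [ l ]≔ u) ᵀ) + y * det ((M [ l ]≔ v) ᵀ)
  detᵀ-linear {suc m} M l x y u v = begin
    ∑ (columnTerm (M [ l ]≔ w))                               ≈⟨ ∑-cong term-linear ⟩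
    ∑ (λ j → x * Tᵤ j + y * Tᵥ j)                             ≈⟨ ∑-distrib-+ (λ j → x * Tᵤ j) (λ j → y * Tᵥ j) ⟩
    ∑ (λ j → x * Tᵤ j) + ∑ (λ j → y * Tᵥ j)                   ≈⟨ +-cong (*-distribˡ-∑ x Tᵤ) (*-distribˡ-∑ y Tᵥ) ⟨
    x * ∑ (columnTerm (M [ l ]≔ u)) + y * ∑ (columnTerm (M [ l ]≔ v))  ∎
    where
    w = λ k → x * u k + y * v k
    Tᵤ = columnTerm (M [ l ]≔ u)
    Tᵥ = columnTerm (M [ l ]≔ v)
    term-linear : ∀ j → columnTerm (M [ l ]≔ w) j ≈ x * Tᵤ j + y * Tᵥ j
    term-linear j with j ≟ l
    ... | yes ≡.refl = begin
      s * ((M [ j ]≔ w) j zero * det (minor j zero (M [ j ]≔ w) ᵀ))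
        ≈⟨ *-congˡ (*-cong (updated-entry w) (det-cong (λ a b → minor-[]≔-same M j w b a))) ⟩
      s * ((x * u zero + y * v zero) * d)
        ≈⟨ solve 6 (λ s x u y v d → s :* ((x :* u :+ y :* v) :* d) := x :* (s :* (u :* d)) :+ y :* (s :* (v :* d)))
                   refl s x (u zero) y (v zero) d ⟩
      x * (s * (u zero * d)) + y * (s * (v zero * d))
        ≈⟨ +-cong (*-congˡ (*-congˡ (*-cong (updated-entry u) (det-cong (λ a b → minor-[]≔-same M j u b a)))))
                  (*-congˡ (*-congˡ (*-cong (updated-entry v) (det-cong (λ a b → minor-[]≔-same M j v b a))))) ⟨
      x * Tᵤ j + y * Tᵥ j
        ∎
      where
      s = sign (toℕ j)
      d = det (minor j zero M ᵀ)
      updated-entry : ∀ z → (M [ j ]≔ z) j zero ≈ z zero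
      updated-entry z = reflexive (≡.cong (λ row → row zero) (updateAt-updates j M))
    ... | no  j≢l = begin
      columnTerm (M [ l ]≔ w) j
        ≈⟨ *-congˡ (*-cong (other-entry w) (det-cong (λ a b → minor-[]≔-other M j≢l w b a))) ⟩
      s * (a * det ((N [ l′ ]≔ (w ∘ suc)) ᵀ))
        ≈⟨ *-congˡ (*-congˡ (detᵀ-linear N l′ x y (u ∘ suc) (v ∘ suc))) ⟩
      s * (a * (x * det ((N [ l′ ]≔ (u ∘ suc)) ᵀ) + y * det ((N [ l′ ]≔ (v ∘ suc)) ᵀ)))
        ≈⟨ solve 6 (λ s a x p y q → s :* (a :* (x :* p :+ y :* q)) := x :* (s :* (a :* p)) :+ y :* (s :* (a :* q)))
                   refl s a x _ y _ ⟩
      x * (s * (a * det ((N [ l′ ]≔ (u ∘ suc)) ᵀ)))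
        + y * (s * (a * det ((N [ l′ ]≔ (v ∘ suc)) ᵀ)))
        ≈⟨ +-cong (*-congˡ (*-congˡ (*-cong (other-entry u) (det-cong (λ a b → minor-[]≔-other M j≢l u b a)))))
                  (*-congˡ (*-congˡ (*-cong (other-entry v) (det-cong (λ a b → minor-[]≔-other M j≢l v b a))))) ⟨
      x * Tᵤ j + y * Tᵥ j
        ∎
      where
      s = sign (toℕ j)
      a = M j zero
      N = minor j zero M
      l′ = punchOut j≢l
      other-entry : ∀ z → (M [ l ]≔ z) j zero ≈ a
      other-entry z = reflexive (≡.cong (λ row → row zero) (updateAt-minimal j l M j≢l))

  detᵀ-cong : ∀ {n} {M N : Mat n} → M ≈ᴹ N → det (M ᵀ) ≈ det (N ᵀ)
  detᵀ-cong M≈N = det-cong λ a b → M≈N b a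

  detᵀ-additive : ∀ {n} → Additive (λ (M : Mat n) → det (M ᵀ))
  detᵀ-additive M i u v = begin
    det ((M [ i ]≔ (λ k → u k + v k)) ᵀ)
      ≈⟨ detᵀ-cong ([]≔-cong i (λ k → +-cong (*-identityˡ _) (*-identityˡ _)) (λ _ _ _ → refl)) ⟨
    det ((M [ i ]≔ (λ k → 1# * u k + 1# * v k)) ᵀ)
      ≈⟨ detᵀ-linear M i 1# 1# u v ⟩
    1# * det ((M [ i ]≔ u) ᵀ) + 1# * det ((M [ i ]≔ v) ᵀ)
      ≈⟨ +-cong (*-identityˡ _) (*-identityˡ _) ⟩
    det ((M [ i ]≔ u) ᵀ) + det ((M [ i ]≔ v) ᵀ)
      ∎

  detᵀ-homogeneous : ∀ {n} → Homogeneous (λ (M : Mat n) → det (M ᵀ))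
  detᵀ-homogeneous M i x u = begin
    det ((M [ i ]≔ (λ k → x * u k)) ᵀ)
      ≈⟨ detᵀ-cong ([]≔-cong i (λ k → trans (+-congˡ (zeroˡ _)) (+-identityʳ _)) (λ _ _ _ → refl)) ⟨
    det ((M [ i ]≔ (λ k → x * u k + 0# * u k)) ᵀ)
      ≈⟨ detᵀ-linear M i x 0# u u ⟩
    x * det ((M [ i ]≔ u) ᵀ) + 0# * det ((M [ i ]≔ u) ᵀ)
      ≈⟨ trans (+-congˡ (zeroˡ _)) (+-identityʳ _) ⟩
    x * det ((M [ i ]≔ u) ᵀ)
      ∎

  adjacentSwap-equal-rows : ∀ {m} (M : Mat (suc m)) k → M (inject₁ k) ≋ M (suc k)
                          → ∀ a → M (adjacentSwap k a) ≋ M a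
  adjacentSwap-equal-rows M k Mk≋Mk+1 a c with a ≟ inject₁ k | a ≟ suc k
  ... | yes ≡.refl | _          = trans (reflexive (≡.cong (λ b → M b c) (adjacentSwap-inject₁ k))) (sym (Mk≋Mk+1 c))
  ... | no  _      | yes ≡.refl = trans (reflexive (≡.cong (λ b → M b c) (adjacentSwap-suc k))) (Mk≋Mk+1 c)
  ... | no  a≢k    | no  a≢k+1  = reflexive (≡.cong (λ b → M b c) (adjacentSwap-other k a a≢k a≢k+1))

  detᵀ-alternating : ∀ n → Alternating (λ (M : Mat n) → det (M ᵀ))
  detᵀ-adjacent : ∀ m (M : Mat (suc m)) k → M (inject₁ k) ≋ M (suc k) → det (M ᵀ) ≈ 0#

  detᵀ-alternating zero    M () j i≢j Mi≋Mj
  detᵀ-alternating (suc m) =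
    FromAdjacentAlternation.alternating (λ M → det (M ᵀ)) detᵀ-cong detᵀ-additive (detᵀ-adjacent m)

  detᵀ-adjacent m M k Mk≋Mk+1 = begin
    ∑ (columnTerm M)
      ≈⟨ ∑-pair (columnTerm M) (inject₁ k) (suc k) (inject₁≢suc k) others-vanish ⟩
    columnTerm M (inject₁ k) + columnTerm M (suc k)
      ≈⟨ +-cong (*-congʳ (reflexive (≡.cong sign (Fin.toℕ-inject₁ k))))
                (*-congˡ (*-cong (sym (Mk≋Mk+1 zero)) (det-cong same-minor))) ⟩
    sign (toℕ k) * (x * d) + - sign (toℕ k) * (x * d)
      ≈⟨ solve 2 (λ s y → s :* y :+ (:- s) :* y := con 0ℤ) refl (sign (toℕ k)) (x * d) ⟩
    0#
      ∎
    where
    x = M (inject₁ k) zero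
    d = det (minor (inject₁ k) zero M ᵀ)
    same-minor : minor (suc k) zero M ᵀ ≈ᴹ minor (inject₁ k) zero M ᵀ
    same-minor a b = trans (reflexive (≡.cong (λ i → M i (suc a)) (≡.sym (adjacentSwap-punchIn k b))))
                           (adjacentSwap-equal-rows M k Mk≋Mk+1 (punchIn (inject₁ k) b) (suc a))
    others-vanish : ∀ j → j ≢ inject₁ k → j ≢ suc k → columnTerm M j ≈ 0#
    others-vanish j j≢k j≢k+1 = trans (*-congˡ (trans (*-congˡ minor-vanishes) (zeroʳ _))) (zeroʳ _)
      where
      minor-vanishes : det (minor j zero M ᵀ) ≈ 0#
      minor-vanishes = detᵀ-alternating m (minor j zero M) (punchOut j≢k) (punchOut j≢k+1)
        (λ eq → inject₁≢suc k (≡.trans (≡.sym (Fin.punchIn-punchOut j≢k))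
                              (≡.trans (≡.cong (punchIn j) eq) (Fin.punchIn-punchOut j≢k+1))))
        (λ c → trans (reflexive (≡.cong (λ i → M i (suc c)) (Fin.punchIn-punchOut j≢k)))
                     (trans (Mk≋Mk+1 (suc c))
                            (reflexive (≡.cong (λ i → M i (suc c)) (≡.sym (Fin.punchIn-punchOut j≢k+1))))))

  detᵀ-isAlternatingMultilinear : ∀ {n} → IsAlternatingMultilinear (λ (M : Mat n) → det (M ᵀ))
  detᵀ-isAlternatingMultilinear {n} = record
    { cong        = detᵀ-cong
    ; additive    = detᵀ-additive
    ; homogeneous = detᵀ-homogeneous
    ; alternating = detᵀ-alternating n
    }

  det-transpose : ∀ {n} (M : Mat n) → det (M ᵀ) ≈ det M
  det-transpose {n} M = begin
    det (M ᵀ)              ≈⟨ det-universal detᵀ-isAlternatingMultilinear M ⟩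
    det M * det (I {n} ᵀ)  ≈⟨ *-congˡ (trans (det-cong {n} (λ a b → I-sym {n} b a)) (det-I {n})) ⟩
    det M * 1#             ≈⟨ *-identityʳ _ ⟩
    det M                  ∎

  det-isAlternatingMultilinear : ∀ {n} → IsAlternatingMultilinear (det {n})
  det-isAlternatingMultilinear = record
    { cong        = det-cong
    ; additive    = λ M i u v → trans (sym (det-transpose (M [ i ]≔ (λ k → u k + v k))))
                      (trans (detᵀ-additive M i u v)
                             (+-cong (det-transpose (M [ i ]≔ u)) (det-transpose (M [ i ]≔ v))))
    ; homogeneous = λ M i x u → trans (sym (det-transpose (M [ i ]≔ (λ k → x * u k))))
                      (trans (detᵀ-homogeneous M i x u) (*-congˡ (det-transpose (M [ i ]≔ u))))
    ; alternating = λ M i j i≢j Mi≋Mj → trans (sym (det-transpose M)) (detᵀ-alternating _ M i j i≢j Mi≋Mj)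
    }

  ⊗-congˡ : ∀ {m n p} {A A′ : Matrix Carrier m n} (B : Matrix Carrier n p) → A ≈ᴹ A′ → (A ⊗ B) ≈ᴹ (A′ ⊗ B)
  ⊗-congˡ B A≈A′ a c = ∑-cong λ k → *-congʳ (A≈A′ a k)

  det-⊗ : ∀ {n} (A B : Mat n) → det (A ⊗ B) ≈ det A * det B
  det-⊗ A B = begin
    det (A ⊗ B)          ≈⟨ det-universal det∘⊗B A ⟩
    det A * det (I ⊗ B)  ≈⟨ *-congˡ (det-cong λ a c → ∑-Iˡ a (λ k → B k c)) ⟩
    det A * det B        ∎
    where
    open IsAlternatingMultilinear det-isAlternatingMultilinear
    ⊗B-[]≔ : ∀ A i u → ((A [ i ]≔ u) ⊗ B) ≈ᴹ ((A ⊗ B) [ i ]≔ (λ c → ∑ (λ k → u k * B k c)))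
    ⊗B-[]≔ A i u a c = reflexive (≡.cong (λ row → row c)
      (map-updateAt {f = λ row c → ∑ (λ k → row k * B k c)} {g = const u} (λ _ → ≡.refl) A i a))
    det∘⊗B : IsAlternatingMultilinear (λ A → det (A ⊗ B))
    det∘⊗B = record
      { cong        = λ A≈A′ → cong (⊗-congˡ B A≈A′)
      ; additive    = λ A i u v → begin
          det ((A [ i ]≔ (λ k → u k + v k)) ⊗ B)
            ≈⟨ cong (⊗B-[]≔ A i _) ⟩
          det ((A ⊗ B) [ i ]≔ (λ c → ∑ (λ k → (u k + v k) * B k c)))
            ≈⟨ cong ([]≔-cong i (λ c → trans (∑-cong λ k → distribʳ (B k c) (u k) (v k))
                                             (∑-distrib-+ (λ k → u k * B k c) (λ k → v k * B k c)))
                                (λ _ _ _ → refl)) ⟩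
          det ((A ⊗ B) [ i ]≔ (λ c → ∑ (λ k → u k * B k c) + ∑ (λ k → v k * B k c)))
            ≈⟨ additive (A ⊗ B) i _ _ ⟩
          det ((A ⊗ B) [ i ]≔ (λ c → ∑ (λ k → u k * B k c)))
            + det ((A ⊗ B) [ i ]≔ (λ c → ∑ (λ k → v k * B k c)))
            ≈⟨ +-cong (cong (⊗B-[]≔ A i u)) (cong (⊗B-[]≔ A i v)) ⟨
          det ((A [ i ]≔ u) ⊗ B) + det ((A [ i ]≔ v) ⊗ B)
            ∎
      ; homogeneous = λ A i x u → begin
          det ((A [ i ]≔ (λ k → x * u k)) ⊗ B)
            ≈⟨ cong (⊗B-[]≔ A i _) ⟩
          det ((A ⊗ B) [ i ]≔ (λ c → ∑ (λ k → (x * u k) * B k c)))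
            ≈⟨ cong ([]≔-cong i (λ c → trans (∑-cong λ k → *-assoc x (u k) (B k c))
                                             (sym (*-distribˡ-∑ x (λ k → u k * B k c))))
                                (λ _ _ _ → refl)) ⟩
          det ((A ⊗ B) [ i ]≔ (λ c → x * ∑ (λ k → u k * B k c)))
            ≈⟨ homogeneous (A ⊗ B) i x _ ⟩
          x * det ((A ⊗ B) [ i ]≔ (λ c → ∑ (λ k → u k * B k c)))
            ≈⟨ *-congˡ (cong (⊗B-[]≔ A i u)) ⟨
          x * det ((A [ i ]≔ u) ⊗ B)
            ∎
      ; alternating = λ A i j i≢j Ai≋Aj → alternating (A ⊗ B) i j i≢j λ c → ∑-cong λ k → *-congʳ (Ai≋Aj k)
      }

  pow-cong : ∀ {x y} → x ≈ y → ∀ k → pow x k ≈ pow y k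
  pow-cong x≈y zero    = refl
  pow-cong x≈y (suc k) = *-cong x≈y (pow-cong x≈y k)

  det-scale : ∀ {n} x (Y : Mat n) → det (λ a b → x * Y a b) ≈ pow x n * det Y
  det-scale {zero}  x Y = sym (*-identityˡ _)
  det-scale {suc n} x Y = begin
    ∑ (λ j → sign (toℕ j) * ((x * Y zero j) * det (λ a b → x * minor zero j Y a b)))
      ≈⟨ ∑-cong (λ j → *-congˡ {sign (toℕ j)} (*-congˡ {x * Y zero j} (det-scale x (minor zero j Y)))) ⟩
    ∑ (λ j → sign (toℕ j) * ((x * Y zero j) * (pow x n * det (minor zero j Y))))
      ≈⟨ ∑-cong (λ j → solve 5 (λ s x y p d → s :* ((x :* y) :* (p :* d)) := (x :* p) :* (s :* (y :* d)))
                               refl (sign (toℕ j)) x (Y zero j) (pow x n) (det (minor zero j Y))) ⟩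
    ∑ (λ j → (x * pow x n) * (sign (toℕ j) * (Y zero j * det (minor zero j Y))))
      ≈⟨ *-distribˡ-∑ (x * pow x n) (λ j → sign (toℕ j) * (Y zero j * det (minor zero j Y))) ⟨
    pow x (suc n) * det Y
      ∎

  -- Cofactors and inverses

  sign-+ : ∀ a b → sign (a ℕ.+ b) ≈ sign a * sign b
  sign-+ zero    b = sym (*-identityˡ _)
  sign-+ (suc a) b = trans (-‿cong (sign-+ a b)) (-‿distribˡ-* _ _)

  sign-square : ∀ a → sign a * sign a ≈ 1#
  sign-square zero    = *-identityˡ _
  sign-square (suc a) = trans (solve 1 (λ s → (:- s) :* (:- s) := s :* s) refl (sign a)) (sign-square a)

  det-[]≔-I : ∀ {m} (M : Mat (suc m)) k l → det (M [ k ]≔ I l) ≈ cofactor M k l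
  det-[]≔-I {m} M k l = begin
    det X                                              ≈⟨ *-identityˡ _ ⟨
    1# * det X                                         ≈⟨ *-congʳ (sign-square (toℕ k)) ⟨
    (sign (toℕ k) * sign (toℕ k)) * det X              ≈⟨ *-assoc _ _ _ ⟩
    sign (toℕ k) * (sign (toℕ k) * det X)              ≈⟨ *-congˡ (moveToFront-sign X k) ⟨
    sign (toℕ k) * det (moveToFront k X)               ≈⟨ *-congˡ expand-first-row ⟩
    sign (toℕ k) * (sign (toℕ l) * det (minor k l M))  ≈⟨ *-assoc _ _ _ ⟨
    sign (toℕ k) * sign (toℕ l) * det (minor k l M)    ≈⟨ *-congʳ (sign-+ (toℕ k) (toℕ l)) ⟨
    cofactor M k l                                     ∎
    where
    open IsAlternatingMultilinear det-isAlternatingMultilinear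
    open FromAdjacentAlternation det cong additive (λ M k → alternating M (inject₁ k) (suc k) (inject₁≢suc k))
      using (moveToFront-sign)
    X = M [ k ]≔ I l
    Xk≡Il : X k ≡ I l
    Xk≡Il = updateAt-updates k M
    expand-first-row : det (moveToFront k X) ≈ sign (toℕ l) * det (minor k l M)
    expand-first-row = begin
      det (moveToFront k X)
        ≈⟨ ∑-single (λ j → sign (toℕ j) * (X k j * det (minor zero j (moveToFront k X)))) l
                    (λ j j≢l → trans (*-congˡ (trans (*-congʳ (trans (reflexive (≡.cong (λ r → r j) Xk≡Il))
                                                                     (I-off (j≢l ∘ ≡.sym))))
                                                     (zeroˡ _)))
                                     (zeroʳ _)) ⟩
      sign (toℕ l) * (X k l * det (minor zero l (moveToFront k X)))
        ≈⟨ *-congˡ (*-cong (trans (reflexive (≡.cong (λ r → r l) Xk≡Il)) (I-diag l))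
                           (det-cong λ a b → reflexive (≡.cong (λ r → r (punchIn l b))
                                                         (updateAt-minimal _ k M (Fin.punchInᵢ≢i k a))))) ⟩
      sign (toℕ l) * (1# * det (minor k l M))
        ≈⟨ *-congˡ (*-identityˡ _) ⟩
      sign (toℕ l) * det (minor k l M)
        ∎

  adjugate : ∀ {m} (M : Mat (suc m)) i k → ∑ (λ l → M i l * cofactor M k l) ≈ I i k * det M
  adjugate {m} M i k = begin
    ∑ (λ l → M i l * cofactor M k l)                 ≈⟨ ∑-cong (λ l → *-congˡ {M i l} (det-[]≔-I M k l)) ⟨
    ∑ (λ l → M i l * det (M [ k ]≔ I l))             ≈⟨ row-linear M k (M i) I ⟨
    det (M [ k ]≔ (λ c → ∑ (λ l → M i l * I l c)))   ≈⟨ cong ([]≔-cong k (λ c → ∑-Iʳ c (M i)) (λ _ _ _ → refl)) ⟩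
    det (M [ k ]≔ M i)                               ≈⟨ by-cases (i ≟ k) ⟩
    I i k * det M                                    ∎
    where
    open IsAlternatingMultilinear det-isAlternatingMultilinear
    open AlternatingMultilinear det-isAlternatingMultilinear
    by-cases : Dec (i ≡ k) → det (M [ k ]≔ M i) ≈ I i k * det M
    by-cases (yes ≡.refl) = trans (cong (≡-rows⇒≈ᴹ (updateAt-id-local i M ≡.refl)))
                                  (sym (trans (*-congʳ (I-diag i)) (*-identityˡ _)))
    by-cases (no i≢k)     = trans (alternating (M [ k ]≔ M i) k i (i≢k ∘ ≡.sym) λ c → reflexive (≡.cong (λ r → r c)
                                     (≡.trans (updateAt-updates k M) (≡.sym (updateAt-minimal i k M i≢k)))))
                                  (sym (trans (*-congʳ (I-off i≢k)) (zeroˡ _)))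

  cofactor≈det*inverse : ∀ {m} (M N : Mat (suc m)) → (N ⊗ M) ≈ᴹ I → ∀ k l → cofactor M k l ≈ det M * N l k
  cofactor≈det*inverse M N N⊗M≈I k l = begin
    cofactor M k l
      ≈⟨ ∑-Iˡ l (cofactor M k) ⟨
    ∑ (λ p → I l p * cofactor M k p)
      ≈⟨ ∑-cong (λ p → *-congʳ {cofactor M k p} (N⊗M≈I l p)) ⟨
    ∑ (λ p → (N ⊗ M) l p * cofactor M k p)
      ≈⟨ ∑-cong (λ p → trans (*-distribʳ-∑ (cofactor M k p) (λ i → N l i * M i p))
                             (∑-cong λ i → *-assoc (N l i) (M i p) (cofactor M k p))) ⟩
    ∑ (λ p → ∑ (λ i → N l i * (M i p * cofactor M k p)))
      ≈⟨ ∑-comm (λ p i → N l i * (M i p * cofactor M k p)) ⟩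
    ∑ (λ i → ∑ (λ p → N l i * (M i p * cofactor M k p)))
      ≈⟨ ∑-cong (λ i → *-distribˡ-∑ (N l i) (λ p → M i p * cofactor M k p)) ⟨
    ∑ (λ i → N l i * ∑ (λ p → M i p * cofactor M k p))
      ≈⟨ ∑-cong (λ i → *-congˡ {N l i} (adjugate M i k)) ⟩
    ∑ (λ i → N l i * (I i k * det M))
      ≈⟨ ∑-cong (λ i → x∙yz≈xz∙y (N l i) (I i k) (det M)) ⟩
    ∑ (λ i → (N l i * det M) * I i k)
      ≈⟨ ∑-Iʳ k (λ i → N l i * det M) ⟩
    N l k * det M
      ≈⟨ *-comm _ _ ⟩
    det M * N l k
      ∎

  ∑-⊗-assoc : ∀ {m n p} (A : Matrix Carrier m n) (B : Matrix Carrier n p) (v : Vector Carrier p) k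
            → ∑ (λ b → A k b * ∑ (λ c → B b c * v c)) ≈ ∑ (λ c → (A ⊗ B) k c * v c)
  ∑-⊗-assoc A B v k = begin
    ∑ (λ b → A k b * ∑ (λ c → B b c * v c))
      ≈⟨ ∑-cong (λ b → *-distribˡ-∑ (A k b) (λ c → B b c * v c)) ⟩
    ∑ (λ b → ∑ (λ c → A k b * (B b c * v c)))
      ≈⟨ ∑-comm (λ b c → A k b * (B b c * v c)) ⟩
    ∑ (λ c → ∑ (λ b → A k b * (B b c * v c)))
      ≈⟨ ∑-cong (λ c → trans (∑-cong λ b → sym (*-assoc (A k b) (B b c) (v c)))
                             (sym (*-distribʳ-∑ (v c) (λ b → A k b * B b c)))) ⟩
    ∑ (λ c → (A ⊗ B) k c * v c)
      ∎

  ∑-product-expand : ∀ {m} (A B : Mat m) (p q : Vector Carrier m) L j k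
                   → ∑ (λ x → (A x j - A L j * p x) * (B k x - B L x * q k))
                     ≈ ((B ⊗ A) k j - q k * (B ⊗ A) L j)
                       - (A L j * ∑ (λ x → B k x * p x) - A L j * q k * ∑ (λ x → B L x * p x))
  ∑-product-expand A B p q L j k = begin
    ∑ (λ x → (A x j - α * p x) * (B k x - B L x * β))
      ≈⟨ ∑-cong (λ x → solve 6 (λ a α p b l β → (a :- α :* p) :* (b :- l :* β)
                                               := (b :* a :- β :* (l :* a)) :- (α :* (b :* p) :- α :* β :* (l :* p)))
                               refl (A x j) α (p x) (B k x) (B L x) β) ⟩
    ∑ (λ x → (B k x * A x j - β * (B L x * A x j)) - (α * (B k x * p x) - α * β * (B L x * p x)))
      ≈⟨ ∑-distrib-- (λ x → B k x * A x j - β * (B L x * A x j))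
                     (λ x → α * (B k x * p x) - α * β * (B L x * p x)) ⟩
    ∑ (λ x → B k x * A x j - β * (B L x * A x j)) - ∑ (λ x → α * (B k x * p x) - α * β * (B L x * p x))
      ≈⟨ +-cong (∑-distrib-- (λ x → B k x * A x j) (λ x → β * (B L x * A x j)))
                (-‿cong (∑-distrib-- (λ x → α * (B k x * p x)) (λ x → α * β * (B L x * p x)))) ⟩
    (∑ (λ x → B k x * A x j) - ∑ (λ x → β * (B L x * A x j)))
      - (∑ (λ x → α * (B k x * p x)) - ∑ (λ x → α * β * (B L x * p x)))
      ≈⟨ +-cong (+-congˡ (-‿cong (*-distribˡ-∑ β (λ x → B L x * A x j))))
                (-‿cong (+-cong (*-distribˡ-∑ α (λ x → B k x * p x))
                                (-‿cong (*-distribˡ-∑ (α * β) (λ x → B L x * p x))))) ⟨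
    ((B ⊗ A) k j - β * (B ⊗ A) L j) - (α * ∑ (λ x → B k x * p x) - α * β * ∑ (λ x → B L x * p x))
      ∎
    where
    α = A L j
    β = q k

  det-inverse : ∀ {n} (M N : Mat n) → (M ⊗ N) ≈ᴹ I → det M * det N ≈ 1#
  det-inverse {n} M N M⊗N≈I = trans (sym (det-⊗ M N)) (trans (det-cong M⊗N≈I) (det-I {n}))

  inverse-row-nonzero : ∀ {n} (M N : Mat n) → (M ⊗ N) ≈ᴹ I → ∀ a → (∀ i → M a i ≈ 0#) → 1# ≈ 0#
  inverse-row-nonzero M N M⊗N≈I a Ma≈0 = begin
    1#                        ≈⟨ I-diag a ⟨
    I a a                     ≈⟨ M⊗N≈I a a ⟨
    ∑ (λ i → M a i * N i a)   ≈⟨ ∑-zero (λ i → trans (*-congʳ (Ma≈0 i)) (zeroˡ (N i a))) ⟩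
    0#                        ∎

  -- The matrices 𝔆^γ(z)

  module _ {n : ℕ} where
    private
      r : ℕ
      r = suc (suc n)
      L : Fin r
      L = last {n}

    frakC≈ : ∀ (M N : Mat r) → (N ⊗ M) ≈ᴹ I → ∀ v j l
           → frakC M v j l ≈ det M * (N (inject₁ l) (inject₁ j) - N L (inject₁ j) * v (inject₁ l))
    frakC≈ M N N⊗M≈I v j l = begin
      cofactor M (inject₁ j) (inject₁ l) - cofactor M (inject₁ j) L * v (inject₁ l)
        ≈⟨ +-cong (cofactor≈det*inverse M N N⊗M≈I (inject₁ j) (inject₁ l))
                  (-‿cong (*-congʳ (cofactor≈det*inverse M N N⊗M≈I (inject₁ j) L))) ⟩
      det M * N (inject₁ l) (inject₁ j) - (det M * N L (inject₁ j)) * v (inject₁ l)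
        ≈⟨ solve 4 (λ d a b x → d :* a :- (d :* b) :* x := d :* (a :- b :* x)) refl
                   (det M) (N (inject₁ l) (inject₁ j)) (N L (inject₁ j)) (v (inject₁ l)) ⟩
      det M * (N (inject₁ l) (inject₁ j) - N L (inject₁ j) * v (inject₁ l))
        ∎

    -- With z′ = z [ L ]≔ 0#: eliminateLast N z = (I − z′ e_Lᵀ) N and restoreLast M z = M (I + z′ e_Lᵀ).
    eliminateLast : Mat r → Vector Carrier r → Mat r
    eliminateLast N z a b = N a b - (z [ L ]≔ 0#) a * N L b

    det-eliminateLast : ∀ (N : Mat r) (z : Vector Carrier r) → det (eliminateLast N z) ≈ det N
    det-eliminateLast N z = begin
      det (eliminateLast N z)
        ≈⟨ det-cong (λ a b → +-congˡ {N a b} (-‿distribˡ-* ((z [ L ]≔ 0#) a) (N L b))) ⟩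
      det (addRowMultiples N L (λ a → - (z [ L ]≔ 0#) a))
        ≈⟨ add-multiples-of-row N L (λ a → - (z [ L ]≔ 0#) a) last-coefficient ⟩
      det N
        ∎
      where
      open AlternatingMultilinear (det-isAlternatingMultilinear {r})
      last-coefficient : - (z [ L ]≔ 0#) L ≈ 0#
      last-coefficient = trans (-‿cong (reflexive (updateAt-updates L z))) -0#≈0#

    restoreLast : Mat r → Vector Carrier r → Mat r
    restoreLast M z a b = M a b + I L b * ∑ (λ c → M a c * (z [ L ]≔ 0#) c)

    restoreLast-inverseˡ : ∀ (M N : Mat r) (z : Vector Carrier r) → (M ⊗ N) ≈ᴹ I
                         → (restoreLast M z ⊗ eliminateLast N z) ≈ᴹ I
    restoreLast-inverseˡ M N z M⊗N≈I a d = begin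
      ∑ (λ b → (M a b + I L b * s) * (N b d - z′ b * N L d))
        ≈⟨ ∑-cong (λ b → solve 6 (λ m i s n ζ l → (m :+ i :* s) :* (n :- ζ :* l)
                                                  := (m :* n :- (m :* ζ) :* l) :+ i :* (s :* (n :- ζ :* l)))
                                 refl (M a b) (I L b) s (N b d) (z′ b) (N L d)) ⟩
      ∑ (λ b → (M a b * N b d - (M a b * z′ b) * N L d) + I L b * (s * (N b d - z′ b * N L d)))
        ≈⟨ ∑-distrib-+ (λ b → M a b * N b d - (M a b * z′ b) * N L d) (λ b → I L b * (s * (N b d - z′ b * N L d))) ⟩
      ∑ (λ b → M a b * N b d - (M a b * z′ b) * N L d) + ∑ (λ b → I L b * (s * (N b d - z′ b * N L d)))
        ≈⟨ +-cong (∑-distrib-- (λ b → M a b * N b d) (λ b → (M a b * z′ b) * N L d))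
                  (∑-Iˡ L (λ b → s * (N b d - z′ b * N L d))) ⟩
      ((M ⊗ N) a d - ∑ (λ b → (M a b * z′ b) * N L d)) + s * (N L d - z′ L * N L d)
        ≈⟨ +-cong (+-cong (M⊗N≈I a d) (-‿cong (sym (*-distribʳ-∑ (N L d) (λ b → M a b * z′ b)))))
                  (*-congˡ (+-congˡ (-‿cong (*-congʳ (reflexive (updateAt-updates L z)))))) ⟩
      (I a d - s * N L d) + s * (N L d - 0# * N L d)
        ≈⟨ solve 3 (λ i s l → (i :- s :* l) :+ s :* (l :- con 0ℤ :* l) := i) refl (I a d) s (N L d) ⟩
      I a d
        ∎
      where
      z′ = z [ L ]≔ 0#
      s = ∑ (λ c → M a c * z′ c)

    restoreLast-last : ∀ (M : Mat r) (z : Vector Carrier r) → z L ≈ 1# → restoreLast M z L L ≈ jfac M z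
    restoreLast-last M z zL≈1 = begin
      M L L + I L L * ∑ (λ c → M L c * z′ c)            ≈⟨ +-congˡ (trans (*-congʳ (I-diag L)) (*-identityˡ _)) ⟩
      M L L + ∑ (λ c → M L c * z′ c)                    ≈⟨ +-comm _ _ ⟩
      ∑ (λ c → M L c * z′ c) + M L L                    ≈⟨ +-congˡ (∑-Iˡ L (M L)) ⟨
      ∑ (λ c → M L c * z′ c) + ∑ (λ c → I L c * M L c)  ≈⟨ ∑-distrib-+ (λ c → M L c * z′ c) (λ c → I L c * M L c) ⟨
      ∑ (λ c → M L c * z′ c + I L c * M L c)            ≈⟨ ∑-cong pointwise ⟩
      ∑ (λ c → M L c * z c)                             ∎
      where
      z′ = z [ L ]≔ 0#
      pointwise : ∀ c → M L c * z′ c + I L c * M L c ≈ M L c * z c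
      pointwise c with c ≟ L
      ... | yes ≡.refl = begin
        M L L * z′ L + I L L * M L L   ≈⟨ +-cong (*-congˡ (reflexive (updateAt-updates L z))) (*-congʳ (I-diag L)) ⟩
        M L L * 0# + 1# * M L L        ≈⟨ trans (+-cong (zeroʳ _) (*-identityˡ _)) (+-identityˡ _) ⟩
        M L L                          ≈⟨ *-identityʳ _ ⟨
        M L L * 1#                     ≈⟨ *-congˡ zL≈1 ⟨
        M L L * z L                    ∎
      ... | no  c≢L    = begin
        M L c * z′ c + I L c * M L c   ≈⟨ +-cong (*-congˡ (reflexive (updateAt-minimal c L z c≢L)))
                                                 (*-congʳ (I-off (c≢L ∘ ≡.sym))) ⟩
        M L c * z c + 0# * M L c       ≈⟨ trans (+-congˡ (zeroˡ _)) (+-identityʳ _) ⟩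
        M L c * z c                    ∎

    det-frakC : ∀ (M N : Mat r) (z : Vector Carrier r) → (M ⊗ N) ≈ᴹ I → (N ⊗ M) ≈ᴹ I → z L ≈ 1#
              → det (frakC M z) ≈ pow (det M) n * jfac M z
    det-frakC M N z M⊗N≈I N⊗M≈I zL≈1 = begin
      det (frakC M z)
        ≈⟨ det-cong (frakC≈ M N N⊗M≈I z) ⟩
      det (λ j l → det M * Y j l)
        ≈⟨ det-scale (det M) Y ⟩
      pow (det M) (suc n) * det Y
        ≈⟨ *-congˡ det-Y ⟩
      (det M * pow (det M) n) * (det N * jfac M z)
        ≈⟨ solve 4 (λ d p e j → (d :* p) :* (e :* j) := p :* ((d :* e) :* j)) refl (det M) (pow (det M) n) (det N) (jfac M z) ⟩
      pow (det M) n * ((det M * det N) * jfac M z)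
        ≈⟨ *-congˡ (trans (*-congʳ (det-inverse M N M⊗N≈I)) (*-identityˡ _)) ⟩
      pow (det M) n * jfac M z
        ∎
      where
      Y : Mat (suc n)
      Y j l = N (inject₁ l) (inject₁ j) - N L (inject₁ j) * z (inject₁ l)
      Q = eliminateLast N z
      Yᵀ≈minor : Y ᵀ ≈ᴹ minor L L Q
      Yᵀ≈minor l j = begin
        N (inject₁ l) (inject₁ j) - N L (inject₁ j) * z (inject₁ l)
          ≈⟨ +-congˡ (-‿cong (trans (*-comm _ _)
                                     (*-congʳ (reflexive (≡.sym (updateAt-minimal _ L z (Fin.fromℕ≢inject₁ ∘ ≡.sym))))))) ⟩
        N (inject₁ l) (inject₁ j) - (z [ L ]≔ 0#) (inject₁ l) * N L (inject₁ j)
          ≡⟨ ≡.cong₂ Q (punchIn-fromℕ l) (punchIn-fromℕ j) ⟨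
        Q (punchIn L l) (punchIn L j)
          ∎
      det-Y : det Y ≈ det N * jfac M z
      det-Y = begin
        det Y                         ≈⟨ det-transpose Y ⟨
        det (Y ᵀ)                     ≈⟨ det-cong Yᵀ≈minor ⟩
        det (minor L L Q)             ≈⟨ trans (*-congʳ (trans (sign-+ (toℕ L) (toℕ L)) (sign-square (toℕ L))))
                                               (*-identityˡ _) ⟨
        cofactor Q L L                ≈⟨ cofactor≈det*inverse Q (restoreLast M z) (restoreLast-inverseˡ M N z M⊗N≈I) L L ⟩
        det Q * restoreLast M z L L   ≈⟨ *-cong (det-eliminateLast N z) (restoreLast-last M z zL≈1) ⟩
        det N * jfac M z              ∎

    frakC-inverseˡ : ∀ (M N : Mat r) (z w : Vector Carrier r) y → (M ⊗ N) ≈ᴹ I → (N ⊗ M) ≈ᴹ I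
                   → z L ≈ 1# → w L ≈ 1# → (∀ k → ∑ (λ b → N k b * w b) ≈ z k * y)
                   → (frakC N w ⊗ frakC M z) ≈ᴹ I
    frakC-inverseˡ M N z w y M⊗N≈I N⊗M≈I zL≈1 wL≈1 Nw≈yz j k = begin
      ∑ (λ l → frakC N w j l * frakC M z l k)
        ≈⟨ ∑-cong (λ l → *-cong (frakC≈ N M M⊗N≈I w j l) (frakC≈ M N N⊗M≈I z l k)) ⟩
      ∑ (λ l → (det N * F (inject₁ l)) * (det M * G (inject₁ l)))
        ≈⟨ ∑-cong (λ l → solve 4 (λ e f d g → (e :* f) :* (d :* g) := (e :* d) :* (f :* g))
                                 refl (det N) (F (inject₁ l)) (det M) (G (inject₁ l))) ⟩
      ∑ (λ l → (det N * det M) * (F (inject₁ l) * G (inject₁ l)))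
        ≈⟨ *-distribˡ-∑ (det N * det M) (λ l → F (inject₁ l) * G (inject₁ l)) ⟨
      (det N * det M) * ∑ (λ l → F (inject₁ l) * G (inject₁ l))
        ≈⟨ *-cong (det-inverse N M N⊗M≈I)
                  (trans (sym (+-identityʳ _)) (trans (+-congˡ (sym last-term-vanishes))
                                                      (sym (∑-init-last (λ x → F x * G x))))) ⟩
      1# * ∑ (λ x → F x * G x)
        ≈⟨ trans (*-identityˡ _) (∑-product-expand M N w z L j′ k′) ⟩
      ((N ⊗ M) k′ j′ - z k′ * (N ⊗ M) L j′) - (α * ∑ (λ x → N k′ x * w x) - α * z k′ * ∑ (λ x → N L x * w x))
        ≈⟨ +-cong (+-cong (N⊗M≈I k′ j′) (-‿cong (*-congˡ (trans (N⊗M≈I L j′) (I-off (Fin.fromℕ≢inject₁ {i = j}))))))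
                  (-‿cong (+-cong (*-congˡ (Nw≈yz k′))
                                  (-‿cong (*-congˡ (trans (Nw≈yz L) (trans (*-congʳ zL≈1) (*-identityˡ y))))))) ⟩
      (I k′ j′ - z k′ * 0#) - (α * (z k′ * y) - α * z k′ * y)
        ≈⟨ solve 4 (λ i ζ a y → (i :- ζ :* con 0ℤ) :- (a :* (ζ :* y) :- a :* ζ :* y) := i) refl (I k′ j′) (z k′) α y ⟩
      I k′ j′
        ≈⟨ trans (I-injective inject₁ Fin.inject₁-injective k j) (I-sym k j) ⟩
      I j k
        ∎
      where
      j′ = inject₁ j
      k′ = inject₁ k
      α = M L j′
      F G : Vector Carrier r
      F x = M x j′ - α * w x
      G x = N k′ x - N L x * z k′
      last-term-vanishes : F L * G L ≈ 0#
      last-term-vanishes = begin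
        (α - α * w L) * G L     ≈⟨ *-congʳ (+-congˡ (-‿cong (trans (*-congˡ wL≈1) (*-identityʳ α)))) ⟩
        (α - α) * G L           ≈⟨ trans (*-congʳ (-‿inverseʳ α)) (zeroˡ _) ⟩
        0#                      ∎

    normalised-image : ∀ (M N : Mat r) (z w : Vector Carrier r) y → (N ⊗ M) ≈ᴹ I → jfac M z * y ≈ 1#
                     → (∀ i → w i * jfac M z ≈ act M z i) → w L ≈ 1# × (∀ k → ∑ (λ b → N k b * w b) ≈ z k * y)
    normalised-image M N z w y N⊗M≈I jy≈1 wj≈Mz = w-last , N·w≈z·y
      where
      w≈Mz·y : ∀ b → w b ≈ act M z b * y
      w≈Mz·y b = begin
        w b                      ≈⟨ *-identityʳ _ ⟨
        w b * 1#                 ≈⟨ *-congˡ jy≈1 ⟨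
        w b * (jfac M z * y)     ≈⟨ *-assoc _ _ _ ⟨
        (w b * jfac M z) * y     ≈⟨ *-congʳ (wj≈Mz b) ⟩
        act M z b * y            ∎
      w-last : w L ≈ 1#
      w-last = trans (w≈Mz·y L) jy≈1
      N·w≈z·y : ∀ k → ∑ (λ b → N k b * w b) ≈ z k * y
      N·w≈z·y k = begin
        ∑ (λ b → N k b * w b)                ≈⟨ ∑-cong (λ b → trans (*-congˡ {N k b} (w≈Mz·y b))
                                                                    (sym (*-assoc (N k b) (act M z b) y))) ⟩
        ∑ (λ b → N k b * act M z b * y)      ≈⟨ *-distribʳ-∑ y (λ b → N k b * act M z b) ⟨
        ∑ (λ b → N k b * act M z b) * y      ≈⟨ *-congʳ (∑-⊗-assoc N M z k) ⟩
        ∑ (λ c → (N ⊗ M) k c * z c) * y      ≈⟨ *-congʳ (trans (∑-cong λ c → *-congʳ {z c} (N⊗M≈I k c)) (∑-Iˡ k z)) ⟩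
        z k * y                              ∎

    frakC-inverse : ∀ (M N : Mat r) (z w : Vector Carrier r) y → (M ⊗ N) ≈ᴹ I → (N ⊗ M) ≈ᴹ I
                  → z L ≈ 1# → jfac M z * y ≈ 1# → (∀ i → w i * jfac M z ≈ act M z i)
                  → IsInverse (frakC N w) (frakC M z)
    frakC-inverse M N z w y M⊗N≈I N⊗M≈I zL≈1 jy≈1 wj≈Mz =
      frakC-inverseˡ M N z w y M⊗N≈I N⊗M≈I zL≈1 wL≈1 N·w≈z·y ,
      frakC-inverseˡ N M w z (jfac M z) N⊗M≈I M⊗N≈I wL≈1 zL≈1 (λ k → sym (wj≈Mz k))
      where
      normalised : w L ≈ 1# × (∀ k → ∑ (λ b → N k b * w b) ≈ z k * y)
      normalised = normalised-image M N z w y N⊗M≈I jy≈1 wj≈Mz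
      wL≈1 = proj₁ normalised
      N·w≈z·y = proj₂ normalised

-- Change of rings

module RingHomomorphism {a ℓa c ℓc} (A : CommutativeRing a ℓa) (C : CommutativeRing c ℓc)
  (ι : CommutativeRing.Carrier A → CommutativeRing.Carrier C)
  (isHom : IsRingHomomorphism (CommutativeRing.rawRing A) (CommutativeRing.rawRing C) ι) where
  open CommutativeRing C hiding (zero)
  open IsRingHomomorphism isHom
  open Lin C
  open Matrices C using (∑-cong; I-diag; I-off)
  private
    module A = CommutativeRing A
    module LinA = Lin A
    module MatricesA = Matrices A

  ι-∑ : ∀ {n} (f : Fin n → A.Carrier) → ι (LinA.∑ f) ≈ ∑ (ι ∘ f)
  ι-∑ {zero}  f = 0#-homo
  ι-∑ {suc n} f = trans (+-homo _ _) (+-congˡ (ι-∑ (f ∘ suc)))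

  ι-sign : ∀ k → ι (LinA.sign k) ≈ sign k
  ι-sign zero    = 1#-homo
  ι-sign (suc k) = trans (-‿homo _) (-‿cong (ι-sign k))

  ι-det : ∀ {n} (M : Matrix A.Carrier n n) → ι (LinA.det M) ≈ det (λ a b → ι (M a b))
  ι-det {zero}  M = 1#-homo
  ι-det {suc n} M = trans (ι-∑ (λ j → LinA.sign (toℕ j) A.* (M zero j A.* LinA.det (LinA.minor zero j M))))
    (∑-cong λ j → trans (*-homo _ _)
      (*-cong (ι-sign (toℕ j)) (trans (*-homo (M zero j) _) (*-congˡ (ι-det (LinA.minor zero j M))))))

  ι-I : ∀ {n} (a b : Fin n) → ι (LinA.I a b) ≈ I a b
  ι-I a b = by-cases (a ≟ b)
    where
    by-cases : Dec (a ≡ b) → ι (LinA.I a b) ≈ I a b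
    by-cases (yes ≡.refl) = trans (⟦⟧-cong (MatricesA.I-diag a)) (trans 1#-homo (sym (I-diag a)))
    by-cases (no a≢b)     = trans (⟦⟧-cong (MatricesA.I-off a≢b)) (trans 0#-homo (sym (I-off a≢b)))

  ι-inverse : ∀ {n} (γ δ : Matrix A.Carrier n n) → (γ LinA.⊗ δ) LinA.≈ᴹ LinA.I
            → ((λ i j → ι (γ i j)) ⊗ (λ i j → ι (δ i j))) ≈ᴹ I
  ι-inverse γ δ γ⊗δ≈I a b = begin
    ∑ (λ k → ι (γ a k) * ι (δ k b))       ≈⟨ ∑-cong (λ k → *-homo (γ a k) (δ k b)) ⟨
    ∑ (λ k → ι (γ a k A.* δ k b))         ≈⟨ ι-∑ (λ k → γ a k A.* δ k b) ⟨
    ι ((γ LinA.⊗ δ) a b)                  ≈⟨ ⟦⟧-cong (γ⊗δ≈I a b) ⟩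
    ι (LinA.I a b)                        ≈⟨ ι-I a b ⟩
    I a b                                 ∎
    where open import Relation.Binary.Reasoning.Setoid setoid

proposition5p8 : ∀ {a ℓa c ℓc k : Level}
  -- A (= F_q[θ]) with an injective ring embedding ι : A → C (C standing for C_∞)
  (A : CommutativeRing a ℓa) (C : CommutativeRing c ℓc) → IsField C
  → (ι : CommutativeRing.Carrier A → CommutativeRing.Carrier C)
  → IsRingHomomorphism (CommutativeRing.rawRing A) (CommutativeRing.rawRing C) ι
  → Injective (CommutativeRing._≈_ A) (CommutativeRing._≈_ C) ι
  -- K (standing for K_∞) is a subset of C containing ι(A)
  → (K : Pred (CommutativeRing.Carrier C) k) → (∀ x → K (ι x))
  -- r = n + 2 ≥ 2; γ ∈ GL_r(A) with inverse δ = γ⁻¹ ∈ Mat_r(A)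
  → (n : ℕ) (γ δ : Matrix (CommutativeRing.Carrier A) (suc (suc n)) (suc (suc n)))
  → Lin.IsInverse A γ δ
  -- z ∈ Ω^r
  → (z : Fin (suc (suc n)) → CommutativeRing.Carrier C) → Lin.InOmega C K z
  -- (i) det 𝔆^γ(z) = det(γ)^(r-2) j(γ,z)
  → (CommutativeRing._≈_ C (Lin.det C (Lin.frakC C (λ i j → ι (γ i j)) z))
       (CommutativeRing._*_ C (Lin.pow C (ι (Lin.det A γ)) n) (Lin.jfac C (λ i j → ι (γ i j)) z)))
  -- (ii) for w = γ·z (i.e. w · j(γ,z) = γ z), 𝔆^{γ⁻¹}(w)⁻¹ = 𝔆^γ(z)
  × (∀ (w : Fin (suc (suc n)) → CommutativeRing.Carrier C)
     → (∀ i → CommutativeRing._≈_ C (CommutativeRing._*_ C (w i) (Lin.jfac C (λ i j → ι (γ i j)) z))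
                                     (Lin.act C (λ i j → ι (γ i j)) z i))
     → Lin.IsInverse C (Lin.frakC C (λ i j → ι (δ i j)) w) (Lin.frakC C (λ i j → ι (γ i j)) z))
proposition5p8 A C isField ι isHom _ K ι[A]⊆K n γ δ (γ⊗δ≈I , δ⊗γ≈I) z (zL≈1 , independent) =
  trans (det-frakC M N z M⊗N≈I N⊗M≈I zL≈1) (*-congʳ (pow-cong (sym (ι-det γ)) n)) ,
  λ w w·j≈γz → frakC-inverse M N z w j⁻¹ M⊗N≈I N⊗M≈I zL≈1 j·j⁻¹≈1 w·j≈γz
  where
  open CommutativeRing C using (Carrier; _≈_; _*_; 0#; 1#; sym; trans; *-congʳ)
  open Lin C
  open Matrices C
  open RingHomomorphism A C ι isHom
  M N : Mat (suc (suc n))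
  M i j = ι (γ i j)
  N i j = ι (δ i j)
  M⊗N≈I : (M ⊗ N) ≈ᴹ I
  M⊗N≈I = ι-inverse γ δ γ⊗δ≈I
  N⊗M≈I : (N ⊗ M) ≈ᴹ I
  N⊗M≈I = ι-inverse δ γ δ⊗γ≈I
  j≉0 : jfac M z ≈ 0# → ⊥
  j≉0 j≈0 = proj₁ isField (inverse-row-nonzero M N M⊗N≈I last
                             (independent (M last) (λ i → ι[A]⊆K (γ last i)) j≈0))
  j⁻¹ : Carrier
  j⁻¹ = proj₁ (proj₂ isField (jfac M z) j≉0)
  j·j⁻¹≈1 : jfac M z * j⁻¹ ≈ 1#
  j·j⁻¹≈1 = proj₂ (proj₂ isField (jfac M z) j≉0)
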